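{- Let $k,q\geq 1$ and let $\varphi$ be a $\mathsf{C}^k_q$-formula. Then for every $n\geq 1$ there exists $\mathbf{F}\in\mathbb{R}\mathcal{L}^k_q$ modelling $\varphi$ for graphs of size $n$.
   Context: A $k$-labelled graph is a finite simple graph with a partial map $\nu\colon[k]\rightharpoonup V$; fully labelled means every vertex carries a label; homomorphisms preserve edges and labels. Removing a label makes it undefined; the product of labelled graphs is the disjoint union with equally labelled vertices identified, loops and parallel edges suppressed. A $k$-construction tree for $F$: rooted tree $(T,r)$ with $\lambda$ assigning $k$-labelled graphs to nodes, $\lambda(r)=F$, leaves fully labelled, one-child nodes (elimination nodes) obtained from the child by removing one label, multi-child nodes equal to the product of the children; elimination depth = max number of elimination nodes on a root-to-leaf path. $\mathcal{L}^k_q$: $k$-labelled graphs with a $k$-construction tree of elimination depth at most $q$. For a class $\mathcal{F}$, $\mathbb{R}\mathcal{F}$ is the set of finite formal real linear combinations $\mathbf{F}=\sum_i c_iF_i$ with $F_i\in\mathcal{F}$, and $\hom(\mathbf{F},G)=\sum_i c_i\hom(F_i,G)$. $\mathsf{C}^k_q$: counting-logic formulae (first-order with $\exists^{\geq t}$) with at most $k$ variables $x_1,\dots,x_k$ and quantifier rank at most $q$; a labelled graph interprets $x_i$ as the vertex with label $i$. $\mathbf{F}$ models $\varphi$ for graphs of size $n$ if for every (appropriately labelled, i.e. with labels for the free variables of $\varphi$) graph $G$ on $n$ vertices, $\hom(\mathbf{F},G)=1$ if $G\models\varphi$ and $\hom(\mathbf{F},G)=0$ otherwise. -}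

module Defs where

open import Data.Bool using (Bool; true; false; _∧_; _∨_; not; if_then_else_)
open import Data.Nat using (ℕ; zero; suc; _≤_; _≤ᵇ_)
open import Data.Fin using (Fin; zero; suc; _≟_)
open import Data.Integer using (+_)
open import Data.Rational using (ℚ; _/_; 0ℚ; _+_; _*_)
open import Data.Maybe using (Maybe; just; nothing; Is-just)
open import Data.List using (List; []; _∷_; map; concatMap; length; filter; allFin)
open import Data.Bool.ListAction using (and)
open import Data.List.Relation.Unary.All using (All)
open import Data.Product using (Σ; ∃; ∃-syntax; _×_; _,_; proj₁; proj₂)
open import Data.Sum using (_⊎_)
open import Data.Empty using (⊥)
open import Relation.Nullary using (¬_)
open import Relation.Nullary.Decidable using (⌊_⌋)
open import Relation.Binary.PropositionalEquality using (_≡_; _≢_)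
open import Function.Bundles using (_⇔_)

record LGraph (k : ℕ) : Set where
  field
    size : ℕ
    adj  : Fin size → Fin size → Bool
    adj-sym : ∀ u v → adj u v ≡ adj v u
    adj-irr : ∀ v → adj v v ≡ false
    lab  : Fin k → Maybe (Fin size)
open LGraph public

FullyLabelled : ∀ {k} → LGraph k → Set
FullyLabelled F = ∀ (v : Fin (size F)) → ∃[ i ] lab F i ≡ just v

RemoveLabel : ∀ {k} → Fin k → LGraph k → LGraph k → Set
RemoveLabel {k} i F F' =
  Σ (size F' ≡ size F) λ where
    _≡_.refl →
      (∀ u v → adj F' u v ≡ adj F u v) ×
      (lab F' i ≡ nothing) ×
      (∀ j → j ≢ i → lab F' j ≡ lab F j)

-- P is the product of A and B: the disjoint union of A and B with equally
-- labelled vertices identified (i.e. the pushout of the vertex sets over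
-- the labels defined in both), loops and parallel edges suppressed.
-- ιA, ιB are the canonical maps into the product.
record IsProduct {k : ℕ} (A B P : LGraph k) : Set where
  field
    ιA : Fin (size A) → Fin (size P)
    ιB : Fin (size B) → Fin (size P)
    glue : ∀ i u v → lab A i ≡ just u → lab B i ≡ just v → ιA u ≡ ιB v
    -- the identification is the least one forced by the labels (pushout)
    universal : ∀ (N : ℕ) (f : Fin (size A) → Fin N) (g : Fin (size B) → Fin N) →
      (∀ (i : Fin k) u v → lab A i ≡ just u → lab B i ≡ just v → f u ≡ g v) →
      Σ (Fin (size P) → Fin N) λ h → ((∀ u → h (ιA u) ≡ f u) × (∀ v → h (ιB v) ≡ g v))
    cover : ∀ x → (∃[ u ] ιA u ≡ x) ⊎ (∃[ v ] ιB v ≡ x)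
    labA : ∀ i u → lab A i ≡ just u → lab P i ≡ just (ιA u)
    labB : ∀ i v → lab B i ≡ just v → lab P i ≡ just (ιB v)
    labN : ∀ i → lab A i ≡ nothing → lab B i ≡ nothing → lab P i ≡ nothing
    edges : ∀ x y → (adj P x y ≡ true) ⇔
      ((x ≢ y) ×
       ((∃[ u ] ∃[ v ] (ιA u ≡ x × ιA v ≡ y × adj A u v ≡ true)) ⊎
        (∃[ u ] ∃[ v ] (ιB u ≡ x × ιB v ≡ y × adj B u v ≡ true))))

-- InL k q F : F has a k-construction tree of elimination depth at most q,
-- i.e. F ∈ 𝓛^k_q.  (Multi-child product nodes are expressed as iterated
-- binary products, which does not change elimination depth.)
data InL (k : ℕ) : ℕ → LGraph k → Set where
  leaf : ∀ {q F} → FullyLabelled F → InL k q F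
  elim : ∀ {q F F'} (i : Fin k) → InL k q F → RemoveLabel i F F' → InL k (suc q) F'
  prod : ∀ {q A B P} → InL k q A → InL k q B → IsProduct A B P → InL k q P

consF : ∀ {m n} → Fin n → (Fin m → Fin n) → Fin (suc m) → Fin n
consF x f zero = x
consF x f (suc i) = f i

allFuns : (m n : ℕ) → List (Fin m → Fin n)
allFuns zero n = (λ ()) ∷ []
allFuns (suc m) n = concatMap (λ x → map (consF x) (allFuns m n)) (allFin n)

isHom : ∀ {k} (F G : LGraph k) → (Fin (size F) → Fin (size G)) → Bool
isHom {k} F G h =
  and (concatMap (λ u → map (λ v → not (adj F u v) ∨ adj G (h u) (h v))
                             (allFin (size F))) (allFin (size F)))
  ∧ and (map labOK (allFin k))
  where
    labOK : Fin k → Bool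
    labOK i with lab F i | lab G i
    ... | nothing | _ = true
    ... | just u | nothing = false
    ... | just u | just w = ⌊ h u ≟ w ⌋

hom : ∀ {k} → LGraph k → LGraph k → ℕ
hom F G = length (filter (λ h → isHom F G h ≡? true) (allFuns (size F) (size G)))
  where
    open import Data.Bool using () renaming (_≟_ to _≡?_)

ℕtoℚ : ℕ → ℚ
ℕtoℚ n = (+ n) / 1

LinComb : ℕ → Set
LinComb k = List (ℚ × LGraph k)

InRL : ∀ k → ℕ → LinComb k → Set
InRL k q 𝐅 = All (λ p → InL k q (proj₂ p)) 𝐅

homL : ∀ {k} → LinComb k → LGraph k → ℚ
homL [] G = 0ℚ
homL ((c , F) ∷ 𝐅) G = c * ℕtoℚ (hom F G) + homL 𝐅 G

data Formula (k : ℕ) : Set where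
  eqA   : Fin k → Fin k → Formula k
  edgeA : Fin k → Fin k → Formula k
  neg   : Formula k → Formula k
  conj  : Formula k → Formula k → Formula k
  exists≥ : ℕ → Fin k → Formula k → Formula k

qr : ∀ {k} → Formula k → ℕ
qr (eqA _ _) = 0
qr (edgeA _ _) = 0
qr (neg φ) = qr φ
qr (conj φ ψ) = qr φ Data.Nat.⊔ qr ψ
qr (exists≥ _ _ φ) = suc (qr φ)

data Free {k : ℕ} (i : Fin k) : Formula k → Set where
  eqˡ : ∀ j → Free i (eqA i j)
  eqʳ : ∀ j → Free i (eqA j i)
  edgeˡ : ∀ j → Free i (edgeA i j)
  edgeʳ : ∀ j → Free i (edgeA j i)
  negF : ∀ {φ} → Free i φ → Free i (neg φ)
  conjˡ : ∀ {φ ψ} → Free i φ → Free i (conj φ ψ)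
  conjʳ : ∀ {φ ψ} → Free i ψ → Free i (conj φ ψ)
  existsF : ∀ {t j φ} → j ≢ i → Free i φ → Free i (exists≥ t j φ)

update : ∀ {k n} → (Fin k → Fin n) → Fin k → Fin n → Fin k → Fin n
update α i v j = if ⌊ j ≟ i ⌋ then v else α j

sat : ∀ {k} (G : LGraph k) → Formula k → (Fin k → Fin (size G)) → Bool
sat G (eqA i j) α = ⌊ α i ≟ α j ⌋
sat G (edgeA i j) α = adj G (α i) (α j)
sat G (neg φ) α = not (sat G φ α)
sat G (conj φ ψ) α = sat G φ α ∧ sat G ψ α
sat G (exists≥ t i φ) α =
  t ≤ᵇ length (filter (λ v → sat G φ (update α i v) Data.Bool.≟ true) (allFin (size G)))

AppropriatelyLabelled : ∀ {k} → Formula k → LGraph k → Set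
AppropriatelyLabelled φ G = ∀ i → Free i φ → Is-just (lab G i)

_⊨_ : ∀ {k} → LGraph k → Formula k → Set
G ⊨ φ = ∀ α → (∀ i → Free i φ → lab G i ≡ just (α i)) → sat G φ α ≡ true

ModelsFor : ∀ {k} → LinComb k → Formula k → ℕ → Set
ModelsFor {k} 𝐅 φ n = ∀ (G : LGraph k) → size G ≡ n → AppropriatelyLabelled φ G →
  (G ⊨ φ → homL 𝐅 G ≡ 1ℚ) × (¬ (G ⊨ φ) → homL 𝐅 G ≡ 0ℚ)
  where open import Data.Rational using (1ℚ)

-- Under G ↦ hom(F, G) the constructions of 𝓛^k_q become operations on functions of G: a product of
-- labelled graphs multiplies homomorphism counts (or yields 0 when the gluing turns an edge into a
-- loop), and removing label i from F sums hom(F, G) over all placements of label i in G. The atoms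
-- x_i = x_j and E(x_i, x_j) are a labelled vertex and a labelled edge, negation is 1 − 𝐅 and
-- conjunction is a product. For ∃^{≥t} x_i φ, eliminating label i from the combination for φ gives
-- one whose value on an n-vertex graph is the number c ∈ {0, …, n} of witnesses; substituting it into
-- the polynomial interpolating [t ≤ c] on the nodes 0, …, n produces the truth value without adding
-- an elimination.

module Submission where

open import Defs
open import Algebra.Bundles using (Ring)
open import Data.Bool using (Bool; true; false; _∧_; _∨_; not; if_then_else_)
import Data.Bool as Bool
open import Data.Bool.ListAction using (and)
open import Data.Bool.Properties using (∧-conicalˡ; ∧-conicalʳ; ⇔→≡)
open import Data.Empty using (⊥; ⊥-elim)
open import Data.Fin using (Fin; zero; suc; toℕ; fromℕ<; _↑ˡ_; _↑ʳ_; splitAt; _≟_; punchIn; punchOut)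
open import Data.Fin.Properties
  using ( any?; toℕ-injective; toℕ-fromℕ<; splitAt-↑ˡ; splitAt-↑ʳ; splitAt⁻¹-↑ˡ; splitAt⁻¹-↑ʳ
        ; punchInᵢ≢i; punchIn-punchOut; punchOut-punchIn; punchOut-cong )
import Data.Integer as ℤ
import Data.Integer.Properties as ℤ
open import Data.List using (List; []; _∷_; _++_; map; concatMap; length; filter; allFin; tabulate; cartesianProductWith)
open import Data.List.Properties using (length-++; filter-++; length-filter; length-tabulate)
open import Data.List.Membership.Propositional using (_∈_; find; lose)
open import Data.List.Membership.Propositional.Properties
  using ( ∈-filter⁺; ∈-filter⁻; ∈-map⁺; ∈-map⁻; ∈-concatMap⁺; ∈-concatMap⁻
        ; ∈-∃++; ∈-++⁺ˡ; ∈-++⁺ʳ; ∈-++⁻; ∈-cartesianProductWith⁺; ∈-allFin )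
open import Data.List.Relation.Unary.Any using (here; there)
open import Data.List.Relation.Unary.All using (All; []; _∷_)
import Data.List.Relation.Unary.All as All
open import Data.List.Relation.Unary.All.Properties using (++⁺; map⁺)
open import Data.List.Relation.Unary.Unique.Propositional using (Unique; []; _∷_)
import Data.List.Relation.Unary.Unique.Propositional.Properties as Unique
open import Data.Maybe using (Maybe; just; nothing; _<∣>_; fromMaybe)
import Data.Maybe as Maybe
open import Data.Maybe.Properties using (just-injective)
open import Data.Maybe.Relation.Unary.Any using () renaming (just to is-just)
open import Data.Nat using (ℕ; zero; suc; _+_; _*_; _≤_; _<_; _≤ᵇ_; z≤n; s≤s)
open import Data.Nat.Properties using (+-suc; ≤-antisym; m≤m⊔n; m≤n⊔m)
import Data.Nat.Properties as ℕ
open import Data.Product using (Σ; ∃; ∃-syntax; _×_; _,_; proj₁; proj₂; map₁)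
open import Data.Rational using (ℚ; 0ℚ; 1ℚ; -_; _-_; toℚᵘ) renaming (_+_ to _+ℚ_; _*_ to _*ℚ_)
import Data.Rational.Properties as ℚ
open import Data.Rational.Solver using (module +-*-Solver)
import Data.Rational.Unnormalised as ℚᵘ
import Data.Rational.Unnormalised.Properties as ℚᵘ
open import Data.Sum using (_⊎_; inj₁; inj₂; [_,_]′)
import Data.Sum as Sum
open import Data.Vec using (Vec; []; _∷_; lookup)
import Data.Vec as Vec
open import Data.Vec.Functional using (removeAt)
open import Data.Vec.Properties using (∷-injective; lookup∘tabulate; tabulate∘lookup; tabulate-cong)
open import Function using (_∘_; case_of_)
open import Function.Bundles using (_⇔_; mk⇔; Equivalence)
open import Relation.Binary.PropositionalEquality
open import Relation.Nullary using (¬_; yes; no)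
open import Relation.Nullary.Decidable using (⌊_⌋; Dec; _×-dec_; _⊎-dec_; ¬?; dec-false; isYes≗does)

open import Algebra.Properties.Semiring.Sum ℕ.+-*-semiring
  using () renaming (sum to sumℕ; sum-cong-≗ to sumℕ-cong; *-distribʳ-sum to *-distribʳ-sumℕ)
open import Algebra.Properties.Semiring.Sum (Ring.semiring ℚ.+-*-ring)
  using (∑-distrib-+)
  renaming (sum to sumℚ; sum-cong-≗ to sumℚ-cong; *-distribˡ-sum to *-distribˡ-sumℚ; sum-remove to sumℚ-remove)
open import Algebra.Properties.CommutativeMonoid.Sum ℚ.*-1-commutativeMonoid
  using () renaming (sum to prodℚ; sum-cong-≗ to prodℚ-cong; sum-remove to prodℚ-remove; sum-replicate-zero to prodℚ-ones)
open import Algebra.Properties.Semiring.Mult (Ring.semiring ℚ.+-*-ring)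
  using (×-homo-+; ×1-homo-*) renaming (_×_ to _·_)

private
  variable
    A B : Set

-- Counting over finite function spaces

-- Stated so that hom F G is definitionally count (isHom F G) (allFuns (size F) (size G)).
count : {A : Set} → (A → Bool) → List A → ℕ
count p xs = length (filter (λ x → p x Bool.≟ true) xs)

count-∷ : ∀ (p : A → Bool) x xs → count p (x ∷ xs) ≡ (if p x then suc (count p xs) else count p xs)
count-∷ p x xs with p x
... | true  = refl
... | false = refl

count-cong : ∀ {p q : A → Bool} → (∀ x → p x ≡ q x) → ∀ xs → count p xs ≡ count q xs
count-cong p≗q []       = refl
count-cong {p = p} {q} p≗q (x ∷ xs)
  rewrite count-∷ p x xs | count-∷ q x xs | p≗q x | count-cong p≗q xs = refl

count-++ : ∀ (p : A → Bool) xs ys → count p (xs ++ ys) ≡ count p xs + count p ys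
count-++ p xs ys = trans (cong length (filter-++ _ xs ys)) (length-++ (filter _ xs))

count≤length : ∀ (p : A → Bool) xs → count p xs ≤ length xs
count≤length p = length-filter _

count-const-∧ : ∀ c (p : A → Bool) xs → count (λ x → c ∧ p x) xs ≡ (if c then count p xs else 0)
count-const-∧ true  p xs = refl
count-const-∧ false p [] = refl
count-const-∧ false p (x ∷ xs) = count-const-∧ false p xs

count-map : ∀ (p : B → Bool) (f : A → B) xs → count p (map f xs) ≡ count (p ∘ f) xs
count-map p f [] = refl
count-map p f (x ∷ xs) rewrite count-∷ p (f x) (map f xs) | count-∷ (p ∘ f) x xs | count-map p f xs = refl

count-pos : ∀ (p : A → Bool) xs {m} → count p xs ≡ suc m → ∃[ x ] p x ≡ true
count-pos p (x ∷ xs) eq with p x in px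
... | true  = x , px
... | false = count-pos p xs eq

count-tabulate : ∀ {n} (p : A → Bool) (f : Fin n → A) → count p (tabulate f) ≡ sumℕ (λ x → count p (f x ∷ []))
count-tabulate {n = zero}  p f = refl
count-tabulate {n = suc n} p f =
  trans (count-++ p (f zero ∷ []) _) (cong (count p (f zero ∷ []) +_) (count-tabulate p (f ∘ suc)))

cartesianProductWith≡concatMap : ∀ {C : Set} (f : A → B → C) xs ys →
  cartesianProductWith f xs ys ≡ concatMap (λ x → map (f x) ys) xs
cartesianProductWith≡concatMap f []       ys = refl
cartesianProductWith≡concatMap f (x ∷ xs) ys = cong (map (f x) ys ++_) (cartesianProductWith≡concatMap f xs ys)

count-concatMap-tabulate : ∀ {n} (p : B → Bool) (g : A → List B) (h : Fin n → A) →
  count p (concatMap g (tabulate h)) ≡ sumℕ (λ x → count p (g (h x)))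
count-concatMap-tabulate {n = zero}  p g h = refl
count-concatMap-tabulate {n = suc n} p g h =
  trans (count-++ p (g (h zero)) _) (cong (count p (g (h zero)) +_) (count-concatMap-tabulate p g (h ∘ suc)))

count-allFuns-suc : ∀ {m n} (P : (Fin (suc m) → Fin n) → Bool) →
  count P (allFuns (suc m) n) ≡ sumℕ (λ x → count (P ∘ consF x) (allFuns m n))
count-allFuns-suc {m} {n} P = trans (count-concatMap-tabulate P (λ x → map (consF x) (allFuns m n)) (λ x → x))
  (sumℕ-cong (λ x → count-map P (consF x) (allFuns m n)))

-- Functions have no decidable equality, so counts over allFuns are transferred to vectors,
-- where duplicate-freeness (Unique) makes sense.
allVecs : ∀ m n → List (Vec (Fin n) m)
allVecs zero    n = [] ∷ []
allVecs (suc m) n = cartesianProductWith _∷_ (allFin n) (allVecs m n)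

allVecs-unique : ∀ m n → Unique (allVecs m n)
allVecs-unique zero    n = [] ∷ []
allVecs-unique (suc m) n = Unique.cartesianProductWith⁺ _∷_ ∷-injective (Unique.allFin⁺ n) (allVecs-unique m n)

∈-allVecs : ∀ {m n} (v : Vec (Fin n) m) → v ∈ allVecs m n
∈-allVecs []      = here refl
∈-allVecs (x ∷ v) = ∈-cartesianProductWith⁺ _∷_ (∈-allFin x) (∈-allVecs v)

consF-cong : ∀ {m n} x {f g : Fin m → Fin n} → f ≗ g → consF x f ≗ consF x g
consF-cong x f≗g zero    = refl
consF-cong x f≗g (suc i) = f≗g i

Extensional : ∀ {a n} → ((Fin a → Fin n) → Bool) → Set
Extensional P = ∀ {f g} → f ≗ g → P f ≡ P g

count-allFuns≡count-allVecs : ∀ m n (P : (Fin m → Fin n) → Bool) → Extensional P →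
  count P (allFuns m n) ≡ count (P ∘ lookup) (allVecs m n)
count-allFuns≡count-allVecs zero n P ext =
  trans (count-∷ P _ []) (trans (cong (λ b → if b then 1 else 0) (ext (λ ()))) (sym (count-∷ (P ∘ lookup) [] [])))
count-allFuns≡count-allVecs (suc m) n P ext = begin
  count P (allFuns (suc m) n)
    ≡⟨ count-allFuns-suc P ⟩
  sumℕ (λ x → count (P ∘ consF x) (allFuns m n))
    ≡⟨ sumℕ-cong (λ x → count-allFuns≡count-allVecs m n (P ∘ consF x) (ext ∘ consF-cong x)) ⟩
  sumℕ (λ x → count (P ∘ consF x ∘ lookup) (allVecs m n))
    ≡⟨ sumℕ-cong (λ x → trans (count-cong (λ w → ext (consF-lookup x w)) (allVecs m n))
                                (sym (count-map (P ∘ lookup) (x ∷_) (allVecs m n)))) ⟩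
  sumℕ (λ x → count (P ∘ lookup) (map (x ∷_) (allVecs m n)))
    ≡⟨ count-concatMap-tabulate (P ∘ lookup) (λ x → map (x ∷_) (allVecs m n)) (λ x → x) ⟨
  count (P ∘ lookup) (concatMap (λ x → map (x ∷_) (allVecs m n)) (allFin n))
    ≡⟨ cong (count (P ∘ lookup)) (cartesianProductWith≡concatMap _∷_ (allFin n) (allVecs m n)) ⟨
  count (P ∘ lookup) (allVecs (suc m) n) ∎
  where
  open ≡-Reasoning
  consF-lookup : ∀ x (w : Vec (Fin n) m) → consF x (lookup w) ≗ lookup (x ∷ w)
  consF-lookup x w zero    = refl
  consF-lookup x w (suc i) = refl

length-≤-injection : ∀ {xs : List A} {ys : List B} (f : A → B) → Unique xs →
  (∀ {x} → x ∈ xs → f x ∈ ys) → (∀ {x y} → x ∈ xs → y ∈ xs → f x ≡ f y → x ≡ y) →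
  length xs ≤ length ys
length-≤-injection {xs = []} f _ _ _ = z≤n
length-≤-injection {xs = x ∷ xs} {ys} f (x∉xs ∷ unique) into inj
  with ys₁ , ys₂ , refl ← ∈-∃++ (into (here refl)) =
  subst (suc (length xs) ≤_) (sym length-ys)
    (s≤s (length-≤-injection f unique into′ (λ p q → inj (there p) (there q))))
  where
  length-ys : length (ys₁ ++ f x ∷ ys₂) ≡ suc (length (ys₁ ++ ys₂))
  length-ys = trans (length-++ ys₁) (trans (+-suc (length ys₁) (length ys₂)) (cong suc (sym (length-++ ys₁))))
  into′ : ∀ {y} → y ∈ xs → f y ∈ ys₁ ++ ys₂
  into′ {y} y∈xs with ∈-++⁻ ys₁ (into (there y∈xs))
  ... | inj₁ p         = ∈-++⁺ˡ p
  ... | inj₂ (there p) = ∈-++⁺ʳ ys₁ p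
  ... | inj₂ (here fy≡fx) = ⊥-elim (All.lookup x∉xs y∈xs (sym (inj (there y∈xs) (here refl) fy≡fx)))

record Embedding {a n b m} (P : (Fin a → Fin n) → Bool) (Q : (Fin b → Fin m) → Bool) : Set where
  field
    to        : (Fin a → Fin n) → (Fin b → Fin m)
    from      : (Fin b → Fin m) → (Fin a → Fin n)
    to-sound  : ∀ f → P f ≡ true → Q (to f) ≡ true
    from-cong : ∀ {g h} → g ≗ h → from g ≗ from h
    from-to   : ∀ f → P f ≡ true → from (to f) ≗ f

embedding⇒count-≤ : ∀ {a n b m} {P : (Fin a → Fin n) → Bool} {Q : (Fin b → Fin m) → Bool} →
  Extensional P → Extensional Q → Embedding P Q → count P (allFuns a n) ≤ count Q (allFuns b m)
embedding⇒count-≤ {a} {n} {b} {m} {P} {Q} extP extQ e =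
  subst₂ _≤_ (sym (count-allFuns≡count-allVecs a n P extP)) (sym (count-allFuns≡count-allVecs b m Q extQ))
    (length-≤-injection F (Unique.filter⁺ P? (allVecs-unique a n)) into inj)
  where
  open Embedding e
  P? : (v : Vec (Fin n) a) → Dec (P (lookup v) ≡ true)
  P? v = P (lookup v) Bool.≟ true
  Q? : (v : Vec (Fin m) b) → Dec (Q (lookup v) ≡ true)
  Q? v = Q (lookup v) Bool.≟ true
  F : Vec (Fin n) a → Vec (Fin m) b
  F v = Vec.tabulate (to (lookup v))
  into : ∀ {v} → v ∈ filter P? (allVecs a n) → F v ∈ filter Q? (allVecs b m)
  into {v} v∈ = ∈-filter⁺ Q? (∈-allVecs (F v))
    (trans (extQ (lookup∘tabulate (to (lookup v)))) (to-sound (lookup v) (proj₂ (∈-filter⁻ P? {xs = allVecs a n} v∈))))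
  inj : ∀ {v w} → v ∈ filter P? (allVecs a n) → w ∈ filter P? (allVecs a n) → F v ≡ F w → v ≡ w
  inj {v} {w} v∈ w∈ Fv≡Fw = trans (sym (tabulate∘lookup v)) (trans (tabulate-cong v≗w) (tabulate∘lookup w))
    where
    to≗ : to (lookup v) ≗ to (lookup w)
    to≗ i = trans (sym (lookup∘tabulate _ i)) (trans (cong (λ u → lookup u i) Fv≡Fw) (lookup∘tabulate _ i))
    v≗w : lookup v ≗ lookup w
    v≗w i = trans (sym (from-to _ (proj₂ (∈-filter⁻ P? {xs = allVecs a n} v∈)) i))
              (trans (from-cong to≗ i) (from-to _ (proj₂ (∈-filter⁻ P? {xs = allVecs a n} w∈)) i))

embeddings⇒count-≡ : ∀ {a n b m} {P : (Fin a → Fin n) → Bool} {Q : (Fin b → Fin m) → Bool} →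
  Extensional P → Extensional Q → Embedding P Q → Embedding Q P →
  count P (allFuns a n) ≡ count Q (allFuns b m)
embeddings⇒count-≡ extP extQ e e′ = ≤-antisym (embedding⇒count-≤ extP extQ e) (embedding⇒count-≤ extQ extP e′)

count-determined : ∀ {a n} {P : (Fin a → Fin n) → Bool} → Extensional P → (h₀ : Fin a → Fin n) →
  (∀ h → P h ≡ true → h ≗ h₀) → count P (allFuns a n) ≡ (if P h₀ then 1 else 0)
count-determined {a} {n} {P} extP h₀ forced =
  trans (embeddings⇒count-≡ extP (λ _ → refl) single single⁻¹) (count-∷ (λ _ → P h₀) (λ ()) [])
  where
  single : Embedding P (λ (_ : Fin 0 → Fin n) → P h₀)
  single = record
    { to = λ _ (); from = λ _ → h₀
    ; to-sound = λ h Ph → trans (extP (λ x → sym (forced h Ph x))) Ph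
    ; from-cong = λ _ _ → refl
    ; from-to = λ h Ph x → sym (forced h Ph x) }
  single⁻¹ : Embedding (λ (_ : Fin 0 → Fin n) → P h₀) P
  single⁻¹ = record
    { to = λ _ → h₀; from = λ _ (); to-sound = λ _ Ph₀ → Ph₀
    ; from-cong = λ _ (); from-to = λ _ _ () }

count-split : ∀ a b n (P : (Fin a → Fin n) → Bool) (Q : (Fin b → Fin n) → Bool) → Extensional P →
  count (λ f → P (f ∘ (_↑ˡ b)) ∧ Q (f ∘ (a ↑ʳ_))) (allFuns (a + b) n)
    ≡ count P (allFuns a n) * count Q (allFuns b n)
count-split zero b n P Q extP = begin
  count (λ f → P (f ∘ (_↑ˡ b)) ∧ Q f) (allFuns b n)
    ≡⟨ count-cong (λ f → cong (_∧ Q f) (extP (λ ()))) (allFuns b n) ⟩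
  count (λ f → P (λ ()) ∧ Q f) (allFuns b n)
    ≡⟨ count-const-∧ (P (λ ())) Q (allFuns b n) ⟩
  (if P (λ ()) then count Q (allFuns b n) else 0)
    ≡⟨ indicator-* (P (λ ())) ⟩
  (if P (λ ()) then 1 else 0) * count Q (allFuns b n)
    ≡⟨ cong (_* count Q (allFuns b n)) (count-∷ P (λ ()) []) ⟨
  count P (allFuns zero n) * count Q (allFuns b n) ∎
  where
  open ≡-Reasoning
  indicator-* : ∀ c → (if c then count Q (allFuns b n) else 0) ≡ (if c then 1 else 0) * count Q (allFuns b n)
  indicator-* true  = sym (ℕ.+-identityʳ _)
  indicator-* false = refl
count-split (suc a) b n P Q extP = begin
  count (λ f → P (f ∘ (_↑ˡ b)) ∧ Q (f ∘ (suc a ↑ʳ_))) (allFuns (suc a + b) n)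
    ≡⟨ count-allFuns-suc {a + b} {n} _ ⟩
  sumℕ (λ x → count (λ f → P (consF x f ∘ (_↑ˡ b)) ∧ Q (f ∘ (a ↑ʳ_))) (allFuns (a + b) n))
    ≡⟨ sumℕ-cong {n} (λ x → count-cong (λ f → cong (_∧ Q (f ∘ (a ↑ʳ_))) (extP (consF-↑ˡ x f)))
                                      (allFuns (a + b) n)) ⟩
  sumℕ (λ x → count (λ f → P (consF x (f ∘ (_↑ˡ b))) ∧ Q (f ∘ (a ↑ʳ_))) (allFuns (a + b) n))
    ≡⟨ sumℕ-cong {n} (λ x → count-split a b n (P ∘ consF x) Q (extP ∘ consF-cong x)) ⟩
  sumℕ (λ x → count (P ∘ consF x) (allFuns a n) * count Q (allFuns b n))
    ≡⟨ *-distribʳ-sumℕ {n} (count Q (allFuns b n)) _ ⟨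
  sumℕ (λ x → count (P ∘ consF x) (allFuns a n)) * count Q (allFuns b n)
    ≡⟨ cong (_* count Q (allFuns b n)) (count-allFuns-suc P) ⟨
  count P (allFuns (suc a) n) * count Q (allFuns b n) ∎
  where
  open ≡-Reasoning
  consF-↑ˡ : ∀ x (f : Fin (a + b) → Fin n) → consF x f ∘ (_↑ˡ b) ≗ consF x (f ∘ (_↑ˡ b))
  consF-↑ˡ x f zero    = refl
  consF-↑ˡ x f (suc i) = refl

-- Homomorphisms

and-true⁻ : ∀ {bs} → and bs ≡ true → ∀ {b} → b ∈ bs → b ≡ true
and-true⁻ {true ∷ bs} _ (here refl) = refl
and-true⁻ {true ∷ bs} e (there b∈) = and-true⁻ e b∈

and-true⁺ : ∀ bs → (∀ {b} → b ∈ bs → b ≡ true) → and bs ≡ true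
and-true⁺ []       _   = refl
and-true⁺ (b ∷ bs) all rewrite all (here refl) = and-true⁺ bs (all ∘ there)

and-map-false : ∀ (f : A → Bool) xs → and (map f xs) ≡ false → ∃[ x ] f x ≡ false
and-map-false f (x ∷ xs) e with f x in fx
... | false = x , fx
... | true  = and-map-false f xs e

adj⇒≢ : ∀ {k} (G : LGraph k) {x y} → adj G x y ≡ true → x ≢ y
adj⇒≢ G {x} e refl = case trans (sym e) (adj-irr G x) of λ ()

IsHom : ∀ {k} (F G : LGraph k) → (Fin (size F) → Fin (size G)) → Set
IsHom {k} F G h = (∀ u v → adj F u v ≡ true → adj G (h u) (h v) ≡ true)
                × (∀ (i : Fin k) u → lab F i ≡ just u → lab G i ≡ just (h u))

module _ {k} (F G : LGraph k) (h : Fin (size F) → Fin (size G)) where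

  private
    edgeCheck : Fin (size F) → Fin (size F) → Bool
    edgeCheck u v = not (adj F u v) ∨ adj G (h u) (h v)

    edgeChecks : List Bool
    edgeChecks = concatMap (λ u → map (edgeCheck u) (allFin (size F))) (allFin (size F))

    ∈-edgeChecks : ∀ u v → edgeCheck u v ∈ edgeChecks
    ∈-edgeChecks u v = ∈-concatMap⁺ (λ u → map (edgeCheck u) (allFin (size F)))
                                    (lose (∈-allFin u) (∈-map⁺ (edgeCheck u) (∈-allFin v)))

    edgeCheck-true : ∀ u v → edgeCheck u v ≡ true → adj F u v ≡ true → adj G (h u) (h v) ≡ true
    edgeCheck-true u v e a rewrite a = e

    edgeChecks-true : (∀ u v → adj F u v ≡ true → adj G (h u) (h v) ≡ true) → ∀ {b} → b ∈ edgeChecks → b ≡ true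
    edgeChecks-true edges b∈ with find (∈-concatMap⁻ (λ u → map (edgeCheck u) (allFin (size F))) {xs = allFin (size F)} b∈)
    ... | u , _ , b∈row with ∈-map⁻ (edgeCheck u) b∈row
    ... | v , _ , refl with adj F u v in a
    ... | true  = edges u v a
    ... | false = refl

  isHom-sound : isHom F G h ≡ true → IsHom F G h
  isHom-sound ok = edges , labels
    where
    edges : ∀ u v → adj F u v ≡ true → adj G (h u) (h v) ≡ true
    edges u v = edgeCheck-true u v (and-true⁻ (∧-conicalˡ _ _ ok) (∈-edgeChecks u v))
    labels : ∀ i u → lab F i ≡ just u → lab G i ≡ just (h u)
    labels i u Fi≡u with and-true⁻ (∧-conicalʳ (and edgeChecks) _ ok) (∈-map⁺ _ (∈-allFin i))
    ... | labelCheck with lab F i | lab G i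
    labels i u refl | labelCheck | just u | just w with h u ≟ w
    ... | yes hu≡w = cong just (sym hu≡w)
    labels i u refl | () | just u | just w | no _
    labels i u refl | () | just u | nothing

  -- The label test of isHom is a function local to Defs that cannot be named, so a failing
  -- test is refuted instead of each test being proved true.
  isHom-complete : IsHom F G h → isHom F G h ≡ true
  isHom-complete (edges , labels) with isHom F G h in ok
  ... | true  = refl
  ... | false with and edgeChecks in edgesOk
  ...   | false = case trans (sym edgesOk) (and-true⁺ edgeChecks (edgeChecks-true edges)) of λ ()
  ...   | true with and-map-false _ (allFin k) ok
  ...     | i , labelCheck with lab F i in Fi | lab G i in Gi
  ...       | nothing | _       = case labelCheck of λ ()
  ...       | just u  | nothing = case trans (sym Gi) (labels i u Fi) of λ ()
  ...       | just u  | just w with h u ≟ w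
  ...         | yes _   = case labelCheck of λ ()
  ...         | no hu≢w = ⊥-elim (hu≢w (just-injective (trans (sym (labels i u Fi)) Gi)))

module _ {k} (F G : LGraph k) where

  IsHom-cong : ∀ {h h′} → h ≗ h′ → IsHom F G h → IsHom F G h′
  IsHom-cong h≗h′ (edges , labels) =
    (λ u v a → subst₂ (λ x y → adj G x y ≡ true) (h≗h′ u) (h≗h′ v) (edges u v a)) ,
    (λ i u l → trans (labels i u l) (cong just (h≗h′ u)))

  isHom-extensional : Extensional (isHom F G)
  isHom-extensional h≗h′ = ⇔→≡ (mk⇔ (isHom-complete F G _ ∘ IsHom-cong h≗h′ ∘ isHom-sound F G _)
                                     (isHom-complete F G _ ∘ IsHom-cong (sym ∘ h≗h′) ∘ isHom-sound F G _))

  hom-determined : (h₀ : Fin (size F) → Fin (size G)) → (∀ h → IsHom F G h → h ≗ h₀) →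
    hom F G ≡ (if isHom F G h₀ then 1 else 0)
  hom-determined h₀ forced = count-determined isHom-extensional h₀ (λ h → forced h ∘ isHom-sound F G h)

-- Quotients of finite sets

record Quotient (m : ℕ) (L : List (Fin m × Fin m)) (c : ℕ) : Set₁ where
  field
    π          : Fin m → Fin c
    rep        : Fin c → Fin m
    π-rep      : ∀ z → π (rep z) ≡ z
    identifies : ∀ {x y} → (x , y) ∈ L → π x ≡ π y
    lift       : ∀ {X : Set} (f : Fin m → X) → (∀ {x y} → (x , y) ∈ L → f x ≡ f y) →
                 Σ (Fin c → X) λ g → ∀ x → g (π x) ≡ f x

module Merge {t} {a b : Fin (suc t)} (a≢b : a ≢ b) where

  merge : Fin (suc t) → Fin t
  merge w with a ≟ w
  ... | yes _   = punchOut a≢b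
  ... | no a≢w  = punchOut a≢w

  merge-≢ : ∀ {w} (a≢w : a ≢ w) → merge w ≡ punchOut a≢w
  merge-≢ {w} a≢w with a ≟ w
  ... | yes a≡w = ⊥-elim (a≢w a≡w)
  ... | no _    = punchOut-cong a refl

  merge-a : merge a ≡ punchOut a≢b
  merge-a with a ≟ a
  ... | yes _   = refl
  ... | no a≢a  = ⊥-elim (a≢a refl)

  merge-b : merge b ≡ merge a
  merge-b = trans (merge-≢ a≢b) (sym merge-a)

  merge-punchIn : ∀ z → merge (punchIn a z) ≡ z
  merge-punchIn z = trans (merge-≢ (punchInᵢ≢i a z ∘ sym)) (punchOut-punchIn a)

  merge-factor : ∀ {X : Set} (h : Fin (suc t) → X) → h a ≡ h b → ∀ w → h (punchIn a (merge w)) ≡ h w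
  merge-factor h ha≡hb w with a ≟ w
  ... | yes refl = trans (cong h (punchIn-punchOut a≢b)) (sym ha≡hb)
  ... | no a≢w   = cong h (punchIn-punchOut a≢w)

identify : ∀ {m L c} → Quotient m L c → ∀ x y → ∃[ c′ ] Quotient m ((x , y) ∷ L) c′
identify {c = zero} Q x y = case Quotient.π Q x of λ ()
identify {m} {L} {c = suc t} Q x y with π x ≟ π y
  where open Quotient Q
... | yes πx≡πy = suc t , record
  { π = π ; rep = rep ; π-rep = π-rep ; identifies = identifies′ ; lift = λ f resp → lift f (resp ∘ there) }
  where
  open Quotient Q
  identifies′ : ∀ {x′ y′} → (x′ , y′) ∈ (x , y) ∷ L → π x′ ≡ π y′
  identifies′ (here refl) = πx≡πy
  identifies′ (there p)   = identifies p
... | no πx≢πy = t , record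
  { π = merge ∘ π ; rep = rep ∘ punchIn (π x)
  ; π-rep = λ z → trans (cong merge (π-rep (punchIn (π x) z))) (merge-punchIn z)
  ; identifies = identifies′ ; lift = lift′ }
  where
  open Quotient Q
  open Merge πx≢πy
  identifies′ : ∀ {x′ y′} → (x′ , y′) ∈ (x , y) ∷ L → merge (π x′) ≡ merge (π y′)
  identifies′ (here refl) = sym merge-b
  identifies′ (there p)   = cong merge (identifies p)
  lift′ : ∀ {X : Set} (f : Fin m → X) → (∀ {x′ y′} → (x′ , y′) ∈ (x , y) ∷ L → f x′ ≡ f y′) →
          Σ (Fin t → X) λ g → ∀ w → g (merge (π w)) ≡ f w
  lift′ f resp with lift f (resp ∘ there)
  ... | g , g∘π≗f = g ∘ punchIn (π x) , λ w →
    trans (merge-factor g (trans (g∘π≗f x) (trans (resp (here refl)) (sym (g∘π≗f y)))) (π w)) (g∘π≗f w)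

quotient : ∀ m L → ∃[ c ] Quotient m L c
quotient m [] = m , record
  { π = λ x → x ; rep = λ x → x ; π-rep = λ _ → refl ; identifies = λ () ; lift = λ f _ → f , λ _ → refl }
quotient m ((x , y) ∷ L) = identify (proj₂ (quotient m L)) x y

-- Products of labelled graphs

isYes⇔ : ∀ {P : Set} (p? : Dec P) → ⌊ p? ⌋ ≡ true ⇔ P
isYes⇔ (yes p) = mk⇔ (λ _ → p) (λ _ → refl)
isYes⇔ (no ¬p) = mk⇔ (λ ()) (λ p → ⊥-elim (¬p p))

ImageEdge : ∀ {k c} (A : LGraph k) → (Fin (size A) → Fin c) → Fin c → Fin c → Set
ImageEdge A ι x y = ∃[ u ] ∃[ v ] (ι u ≡ x × ι v ≡ y × adj A u v ≡ true)

imageEdge? : ∀ {k c} (A : LGraph k) (ι : Fin (size A) → Fin c) x y → Dec (ImageEdge A ι x y)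
imageEdge? A ι x y = any? λ u → any? λ v → ι u ≟ x ×-dec ι v ≟ y ×-dec adj A u v Bool.≟ true

ImageEdge-sym : ∀ {k c} (A : LGraph k) (ι : Fin (size A) → Fin c) {x y} → ImageEdge A ι x y → ImageEdge A ι y x
ImageEdge-sym A ι (u , v , refl , refl , a) = v , u , refl , refl , trans (adj-sym A v u) a

module _ {k} (A B : LGraph k) where

  private
    sA sB : ℕ
    sA = size A
    sB = size B

    gluePair : Maybe (Fin sA) → Maybe (Fin sB) → List (Fin (sA + sB) × Fin (sA + sB))
    gluePair (just u) (just v) = (u ↑ˡ sB , sA ↑ʳ v) ∷ []
    gluePair _        _        = []

    gluedPairs : List (Fin (sA + sB) × Fin (sA + sB))
    gluedPairs = concatMap (λ i → gluePair (lab A i) (lab B i)) (allFin k)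

    ∈-gluedPairs⁺ : ∀ i {u v} → lab A i ≡ just u → lab B i ≡ just v → (u ↑ˡ sB , sA ↑ʳ v) ∈ gluedPairs
    ∈-gluedPairs⁺ i {u} {v} Ai Bi = ∈-concatMap⁺ (λ i → gluePair (lab A i) (lab B i))
      (lose (∈-allFin i) (subst₂ (λ ma mb → (u ↑ˡ sB , sA ↑ʳ v) ∈ gluePair ma mb) (sym Ai) (sym Bi) (here refl)))

    ∈-gluedPairs⁻ : ∀ {x y} → (x , y) ∈ gluedPairs → ∃[ i ] ∃[ u ] ∃[ v ]
      (lab A i ≡ just u × lab B i ≡ just v × x ≡ u ↑ˡ sB × y ≡ sA ↑ʳ v)
    ∈-gluedPairs⁻ p with find (∈-concatMap⁻ (λ i → gluePair (lab A i) (lab B i)) {xs = allFin k} p)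
    ... | i , _ , p′ with lab A i in Ai | lab B i in Bi
    ∈-gluedPairs⁻ _ | i , _ , here refl | just u | just v = i , u , v , Ai , Bi , refl , refl

    c : ℕ
    c = proj₁ (quotient (sA + sB) gluedPairs)
    open Quotient (proj₂ (quotient (sA + sB) gluedPairs))

    ιA : Fin sA → Fin c
    ιA u = π (u ↑ˡ sB)

    ιB : Fin sB → Fin c
    ιB v = π (sA ↑ʳ v)

    edge? : ∀ x y → Dec (x ≢ y × (ImageEdge A ιA x y ⊎ ImageEdge B ιB x y))
    edge? x y = ¬? (x ≟ y) ×-dec (imageEdge? A ιA x y ⊎-dec imageEdge? B ιB x y)

    edge-sym : ∀ x y → ⌊ edge? x y ⌋ ≡ ⌊ edge? y x ⌋
    edge-sym x y = ⇔→≡ (mk⇔ (λ e → from (isYes⇔ (edge? y x)) (flip (to (isYes⇔ (edge? x y)) e)))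
                            (λ e → from (isYes⇔ (edge? x y)) (flip (to (isYes⇔ (edge? y x)) e))))
      where
      open Equivalence
      flip : ∀ {x y} → x ≢ y × (ImageEdge A ιA x y ⊎ ImageEdge B ιB x y) →
                       y ≢ x × (ImageEdge A ιA y x ⊎ ImageEdge B ιB y x)
      flip (x≢y , e) = x≢y ∘ sym , Sum.map (ImageEdge-sym A ιA) (ImageEdge-sym B ιB) e

    pushout : LGraph k
    pushout = record
      { size = c
      ; adj = λ x y → ⌊ edge? x y ⌋
      ; adj-sym = edge-sym
      ; adj-irr = λ x → trans (isYes≗does (edge? x x)) (dec-false (edge? x x) (λ (x≢x , _) → x≢x refl))
      ; lab = λ i → Maybe.map ιA (lab A i) <∣> Maybe.map ιB (lab B i) }

    pushout-isProduct : IsProduct A B pushout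
    pushout-isProduct = record
      { ιA = ιA ; ιB = ιB
      ; glue = λ i u v Ai Bi → identifies (∈-gluedPairs⁺ i Ai Bi)
      ; universal = universal
      ; cover = cover
      ; labA = λ i u Ai → cong (λ ma → Maybe.map ιA ma <∣> Maybe.map ιB (lab B i)) Ai
      ; labB = labB
      ; labN = λ i Ai Bi → cong₂ (λ ma mb → Maybe.map ιA ma <∣> Maybe.map ιB mb) Ai Bi
      ; edges = λ x y → isYes⇔ (edge? x y) }
      where
      universal : ∀ N (f : Fin sA → Fin N) (g : Fin sB → Fin N) →
        (∀ i u v → lab A i ≡ just u → lab B i ≡ just v → f u ≡ g v) →
        Σ (Fin c → Fin N) λ h → (∀ u → h (ιA u) ≡ f u) × (∀ v → h (ιB v) ≡ g v)
      universal N f g compatible with lift ([ f , g ]′ ∘ splitAt sA) respects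
        where
        respects : ∀ {x y} → (x , y) ∈ gluedPairs → [ f , g ]′ (splitAt sA x) ≡ [ f , g ]′ (splitAt sA y)
        respects p with ∈-gluedPairs⁻ p
        ... | i , u , v , Ai , Bi , refl , refl
          rewrite splitAt-↑ˡ sA u sB | splitAt-↑ʳ sA sB v = compatible i u v Ai Bi
      ... | h , h∘π≗ = h , (λ u → trans (h∘π≗ (u ↑ˡ sB)) (cong [ f , g ]′ (splitAt-↑ˡ sA u sB)))
                         , (λ v → trans (h∘π≗ (sA ↑ʳ v)) (cong [ f , g ]′ (splitAt-↑ʳ sA sB v)))
      cover : ∀ x → (∃[ u ] ιA u ≡ x) ⊎ (∃[ v ] ιB v ≡ x)
      cover x with splitAt sA (rep x) in split
      ... | inj₁ u = inj₁ (u , trans (cong π (splitAt⁻¹-↑ˡ split)) (π-rep x))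
      ... | inj₂ v = inj₂ (v , trans (cong π (splitAt⁻¹-↑ʳ split)) (π-rep x))
      labB : ∀ i v → lab B i ≡ just v → lab pushout i ≡ just (ιB v)
      labB i v Bi with lab A i in Ai
      ... | just u  = cong just (identifies (∈-gluedPairs⁺ i Ai Bi))
      ... | nothing rewrite Bi = refl

  -- Only the IsProduct interface is used below; keeping it abstract stops the type checker
  -- from unfolding the quotient construction.
  abstract
    product : LGraph k
    product = pushout

    product-isProduct : IsProduct A B product
    product-isProduct = pushout-isProduct

module _ {k} {A B P : LGraph k} (isProduct : IsProduct A B P) where

  open IsProduct isProduct

  private
    sA sB : ℕ
    sA = size A
    sB = size B

  Collapses : Set
  Collapses = (∃[ u ] ∃[ v ] (adj A u v ≡ true × ιA u ≡ ιA v))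
            ⊎ (∃[ u ] ∃[ v ] (adj B u v ≡ true × ιB u ≡ ιB v))

  collapses? : Dec Collapses
  collapses? = (any? λ u → any? λ v → adj A u v Bool.≟ true ×-dec ιA u ≟ ιA v)
         ⊎-dec (any? λ u → any? λ v → adj B u v Bool.≟ true ×-dec ιB u ≟ ιB v)

  module _ (G : LGraph k) where

    glueHoms : ∀ {a b} → IsHom A G a → IsHom B G b →
      Σ (Fin (size P) → Fin (size G)) λ h → (∀ u → h (ιA u) ≡ a u) × (∀ v → h (ιB v) ≡ b v)
    glueHoms {a} {b} (_ , labelsA) (_ , labelsB) =
      universal (size G) a b (λ i u v Ai Bi → just-injective (trans (sym (labelsA i u Ai)) (labelsB i v Bi)))

    IsHom-glue : ∀ {h} → IsHom A G (h ∘ ιA) → IsHom B G (h ∘ ιB) → IsHom P G h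
    IsHom-glue {h} (edgesA , labelsA) (edgesB , labelsB) = edgesP , labelsP
      where
      edgesP : ∀ x y → adj P x y ≡ true → adj G (h x) (h y) ≡ true
      edgesP x y e with proj₂ (Equivalence.to (edges x y) e)
      ... | inj₁ (u , v , refl , refl , a) = edgesA u v a
      ... | inj₂ (u , v , refl , refl , b) = edgesB u v b
      labelsP : ∀ i x → lab P i ≡ just x → lab G i ≡ just (h x)
      labelsP i x Pi with lab A i in Ai | lab B i in Bi
      ... | just u  | _       = trans (labelsA i u Ai) (cong (just ∘ h) (just-injective (trans (sym (labA i u Ai)) Pi)))
      ... | nothing | just v  = trans (labelsB i v Bi) (cong (just ∘ h) (just-injective (trans (sym (labB i v Bi)) Pi)))
      ... | nothing | nothing = case trans (sym (labN i Ai Bi)) Pi of λ ()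

    IsHom-restrictA : ∀ {h} → ¬ Collapses → IsHom P G h → IsHom A G (h ∘ ιA)
    IsHom-restrictA no-collapse (edgesP , labelsP) =
      (λ u v a → edgesP _ _ (Equivalence.from (edges _ _)
                   ((λ eq → no-collapse (inj₁ (u , v , a , eq))) , inj₁ (u , v , refl , refl , a)))) ,
      (λ i u Ai → labelsP i _ (labA i u Ai))

    IsHom-restrictB : ∀ {h} → ¬ Collapses → IsHom P G h → IsHom B G (h ∘ ιB)
    IsHom-restrictB no-collapse (edgesP , labelsP) =
      (λ u v b → edgesP _ _ (Equivalence.from (edges _ _)
                   ((λ eq → no-collapse (inj₂ (u , v , b , eq))) , inj₂ (u , v , refl , refl , b)))) ,
      (λ i v Bi → labelsP i _ (labB i v Bi))

    private
      n : ℕ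
      n = size G

      Both : (Fin (sA + sB) → Fin n) → Bool
      Both f = isHom A G (f ∘ (_↑ˡ sB)) ∧ isHom B G (f ∘ (sA ↑ʳ_))

      Both-extensional : Extensional Both
      Both-extensional f≗g =
        cong₂ _∧_ (isHom-extensional A G (f≗g ∘ (_↑ˡ sB))) (isHom-extensional B G (f≗g ∘ (sA ↑ʳ_)))

      restrict : (Fin (size P) → Fin n) → (Fin (sA + sB) → Fin n)
      restrict h = [ h ∘ ιA , h ∘ ιB ]′ ∘ splitAt sA

      extend : (Fin (sA + sB) → Fin n) → (Fin (size P) → Fin n)
      extend f x = [ (λ (u , _) → f (u ↑ˡ sB)) , (λ (v , _) → f (sA ↑ʳ v)) ]′ (cover x)

      restrict-↑ˡ : ∀ h u → restrict h (u ↑ˡ sB) ≡ h (ιA u)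
      restrict-↑ˡ h u = cong [ h ∘ ιA , h ∘ ιB ]′ (splitAt-↑ˡ sA u sB)

      restrict-↑ʳ : ∀ h v → restrict h (sA ↑ʳ v) ≡ h (ιB v)
      restrict-↑ʳ h v = cong [ h ∘ ιA , h ∘ ιB ]′ (splitAt-↑ʳ sA sB v)

      extend-cong : ∀ {f g} → f ≗ g → extend f ≗ extend g
      extend-cong f≗g x with cover x
      ... | inj₁ _ = f≗g _
      ... | inj₂ _ = f≗g _

      restrict-cong : ∀ {g h} → g ≗ h → restrict g ≗ restrict h
      restrict-cong g≗h w with splitAt sA w
      ... | inj₁ u = g≗h (ιA u)
      ... | inj₂ v = g≗h (ιB v)

      extend-restrict : ∀ h → extend (restrict h) ≗ h
      extend-restrict h x with cover x
      ... | inj₁ (u , refl) = restrict-↑ˡ h u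
      ... | inj₂ (v , refl) = restrict-↑ʳ h v

      module Good {f} (ok : Both f ≡ true) where

        homA : IsHom A G (f ∘ (_↑ˡ sB))
        homA = isHom-sound A G _ (∧-conicalˡ _ _ ok)

        homB : IsHom B G (f ∘ (sA ↑ʳ_))
        homB = isHom-sound B G _ (∧-conicalʳ (isHom A G (f ∘ (_↑ˡ sB))) _ ok)

        glued : Σ (Fin (size P) → Fin n) λ h → (∀ u → h (ιA u) ≡ f (u ↑ˡ sB)) × (∀ v → h (ιB v) ≡ f (sA ↑ʳ v))
        glued = glueHoms homA homB

        extend≗glued : extend f ≗ proj₁ glued
        extend≗glued x with cover x
        ... | inj₁ (u , refl) = sym (proj₁ (proj₂ glued) u)
        ... | inj₂ (v , refl) = sym (proj₂ (proj₂ glued) v)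

        extend-ιA : ∀ u → extend f (ιA u) ≡ f (u ↑ˡ sB)
        extend-ιA u = trans (extend≗glued (ιA u)) (proj₁ (proj₂ glued) u)

        extend-ιB : ∀ v → extend f (ιB v) ≡ f (sA ↑ʳ v)
        extend-ιB v = trans (extend≗glued (ιB v)) (proj₂ (proj₂ glued) v)

        restrict-extend : restrict (extend f) ≗ f
        restrict-extend w with splitAt sA w in split
        ... | inj₁ u = trans (extend-ιA u) (cong f (splitAt⁻¹-↑ˡ split))
        ... | inj₂ v = trans (extend-ιB v) (cong f (splitAt⁻¹-↑ʳ split))

        extend-isHom : isHom P G (extend f) ≡ true
        extend-isHom = isHom-complete P G _
          (IsHom-glue (IsHom-cong A G (sym ∘ extend-ιA) homA) (IsHom-cong B G (sym ∘ extend-ιB) homB))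

    hom-product : ¬ Collapses → hom P G ≡ hom A G * hom B G
    hom-product no-collapse =
      trans (embeddings⇒count-≡ (isHom-extensional P G) Both-extensional restriction extension)
            (count-split sA sB n (isHom A G) (isHom B G) (isHom-extensional A G))
      where
      restriction : Embedding (isHom P G) Both
      restriction = record
        { to = restrict ; from = extend
        ; to-sound = λ h ok → let hom = isHom-sound P G h ok in cong₂ _∧_
            (isHom-complete A G _ (IsHom-cong A G (sym ∘ restrict-↑ˡ h) (IsHom-restrictA no-collapse hom)))
            (isHom-complete B G _ (IsHom-cong B G (sym ∘ restrict-↑ʳ h) (IsHom-restrictB no-collapse hom)))
        ; from-cong = extend-cong
        ; from-to = λ h _ → extend-restrict h }
      extension : Embedding Both (isHom P G)
      extension = record
        { to = extend ; from = restrict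
        ; to-sound = λ f ok → Good.extend-isHom {f} ok
        ; from-cong = restrict-cong
        ; from-to = λ f ok → Good.restrict-extend {f} ok }

    collapse-no-homs : Collapses → ∀ {a b} → IsHom A G a → IsHom B G b → ⊥
    collapse-no-homs collapse homA homB with glueHoms homA homB | collapse
    ... | h , h∘ιA≗a , _ | inj₁ (u , v , e , ιAu≡ιAv) =
      adj⇒≢ G (proj₁ homA u v e) (trans (sym (h∘ιA≗a u)) (trans (cong h ιAu≡ιAv) (h∘ιA≗a v)))
    ... | h , _ , h∘ιB≗b | inj₂ (u , v , e , ιBu≡ιBv) =
      adj⇒≢ G (proj₁ homB u v e) (trans (sym (h∘ιB≗b u)) (trans (cong h ιBu≡ιBv) (h∘ιB≗b v)))

    hom-collapse : Collapses → hom A G * hom B G ≡ 0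
    hom-collapse collapse with hom A G in homsA | hom B G in homsB
    ... | zero  | _     = refl
    ... | suc m | zero  = ℕ.*-zeroʳ (suc m)
    ... | suc _ | suc _ with count-pos (isHom A G) (allFuns sA n) homsA | count-pos (isHom B G) (allFuns sB n) homsB
    ... | a , okA | b , okB = ⊥-elim (collapse-no-homs collapse (isHom-sound A G a okA) (isHom-sound B G b okB))

-- Removing and placing labels

module _ {k : ℕ} where

  removeLabel : Fin k → LGraph k → LGraph k
  removeLabel i F = record F { lab = λ j → if ⌊ j ≟ i ⌋ then nothing else lab F j }

  setLabel : (G : LGraph k) → Fin k → Fin (size G) → LGraph k
  setLabel G i v = record G { lab = λ j → if ⌊ j ≟ i ⌋ then just v else lab G j }

  module _ {A : Set} {i : Fin k} {x y : A} where

    if-≟-refl : (if ⌊ i ≟ i ⌋ then x else y) ≡ x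
    if-≟-refl with i ≟ i
    ... | yes _  = refl
    ... | no i≢i = ⊥-elim (i≢i refl)

    if-≟-≢ : ∀ {j} → j ≢ i → (if ⌊ j ≟ i ⌋ then x else y) ≡ y
    if-≟-≢ {j} j≢i with j ≟ i
    ... | yes j≡i = ⊥-elim (j≢i j≡i)
    ... | no _    = refl

  removeLabel-correct : ∀ i F → RemoveLabel i F (removeLabel i F)
  removeLabel-correct i F = refl , (λ _ _ → refl) , if-≟-refl {i = i} , λ j → if-≟-≢

  module _ {F G : LGraph k} {i : Fin k} {u : Fin (size F)} (Fi≡u : lab F i ≡ just u) where

    private
      n : ℕ
      n = size G

      Labelled : (Fin (suc (size F)) → Fin n) → Bool
      Labelled f = isHom F (setLabel G i (f zero)) (f ∘ suc)

      Labelled-extensional : Extensional Labelled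
      Labelled-extensional {f} {g} f≗g rewrite f≗g zero = isHom-extensional F (setLabel G i (g zero)) (f≗g ∘ suc)

      tag : (Fin (size F) → Fin n) → (Fin (suc (size F)) → Fin n)
      tag h = consF (h u) h

      tag-cong : ∀ {g h} → g ≗ h → tag g ≗ tag h
      tag-cong g≗h zero    = g≗h u
      tag-cong g≗h (suc x) = g≗h x

      IsHom-tag : ∀ {h} → IsHom (removeLabel i F) G h → IsHom F (setLabel G i (h u)) h
      IsHom-tag {h} (edges , labels) = edges , labels′
        where
        labels′ : ∀ j w → lab F j ≡ just w → lab (setLabel G i (h u)) j ≡ just (h w)
        labels′ j w Fj with j ≟ i
        ... | yes refl = cong (just ∘ h) (just-injective (trans (sym Fi≡u) Fj))
        ... | no j≢i   = labels j w (trans (if-≟-≢ j≢i) Fj)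

      IsHom-untag : ∀ {f} → Labelled f ≡ true → IsHom (removeLabel i F) G (f ∘ suc)
      IsHom-untag {f} ok with isHom-sound F (setLabel G i (f zero)) (f ∘ suc) ok
      ... | edges , labels = edges , labels′
        where
        labels′ : ∀ j w → lab (removeLabel i F) j ≡ just w → lab G j ≡ just (f (suc w))
        labels′ j w F′j with j ≟ i
        ... | yes refl = case F′j of λ ()
        ... | no j≢i   = trans (sym (if-≟-≢ j≢i)) (labels j w F′j)

      tag-untag : ∀ f → Labelled f ≡ true → tag (f ∘ suc) ≗ f
      tag-untag f ok zero    = just-injective
        (trans (sym (proj₂ (isHom-sound F (setLabel G i (f zero)) (f ∘ suc) ok) i u Fi≡u)) (if-≟-refl {i = i}))
      tag-untag f ok (suc x) = refl

    hom-removeLabel : hom (removeLabel i F) G ≡ sumℕ (λ v → hom F (setLabel G i v))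
    hom-removeLabel =
      trans (embeddings⇒count-≡ (isHom-extensional (removeLabel i F) G) Labelled-extensional tagging untagging)
            (count-allFuns-suc Labelled)
      where
      tagging : Embedding (isHom (removeLabel i F) G) Labelled
      tagging = record
        { to = tag ; from = _∘ suc
        ; to-sound = λ h ok → isHom-complete F _ h (IsHom-tag (isHom-sound (removeLabel i F) G h ok))
        ; from-cong = λ g≗h → g≗h ∘ suc
        ; from-to = λ _ _ _ → refl }
      untagging : Embedding Labelled (isHom (removeLabel i F) G)
      untagging = record
        { to = _∘ suc ; from = tag
        ; to-sound = λ f ok → isHom-complete (removeLabel i F) G _ (IsHom-untag {f} ok)
        ; from-cong = tag-cong
        ; from-to = tag-untag }

  hom-setLabel-unlabelled : ∀ {F G : LGraph k} {i} → lab F i ≡ nothing → ∀ v → hom F (setLabel G i v) ≡ hom F G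
  hom-setLabel-unlabelled {F} {G} {i} Fi≡∅ v = count-cong same (allFuns (size F) (size G))
    where
    same : ∀ h → isHom F (setLabel G i v) h ≡ isHom F G h
    same h = ⇔→≡ (mk⇔ (isHom-complete F G h ∘ forget ∘ isHom-sound F _ h)
                       (isHom-complete F _ h ∘ remember ∘ isHom-sound F G h))
      where
      forget : IsHom F (setLabel G i v) h → IsHom F G h
      forget (edges , labels) = edges , λ j w Fj → case j ≟ i of λ where
        (yes refl) → case trans (sym Fi≡∅) Fj of λ ()
        (no j≢i)   → trans (sym (if-≟-≢ j≢i)) (labels j w Fj)
      remember : IsHom F G h → IsHom F (setLabel G i v) h
      remember (edges , labels) = edges , λ j w Fj → case j ≟ i of λ where
        (yes refl) → case trans (sym Fi≡∅) Fj of λ ()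
        (no j≢i)   → trans (if-≟-≢ j≢i) (labels j w Fj)

-- Rational arithmetic

toℚᵘ-ℕtoℚ : ∀ m → toℚᵘ (ℕtoℚ m) ℚᵘ.≃ ℚᵘ.mkℚᵘ (ℤ.+ m) 0
toℚᵘ-ℕtoℚ m = ℚ.toℚᵘ-fromℚᵘ (ℚᵘ.mkℚᵘ (ℤ.+ m) 0)

ℕtoℚ-suc : ∀ n → ℕtoℚ (suc n) ≡ 1ℚ +ℚ ℕtoℚ n
ℕtoℚ-suc n = ℚ.toℚᵘ-injective (begin
  toℚᵘ (ℕtoℚ (suc n))                          ≈⟨ toℚᵘ-ℕtoℚ (suc n) ⟩
  ℚᵘ.mkℚᵘ (ℤ.+ suc n) 0                        ≈⟨ ℚᵘ.*≡* cross-multiplied ⟨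
  ℚᵘ.mkℚᵘ (ℤ.+ 1) 0 ℚᵘ.+ ℚᵘ.mkℚᵘ (ℤ.+ n) 0      ≈⟨ ℚᵘ.+-cong (toℚᵘ-ℕtoℚ 1) (toℚᵘ-ℕtoℚ n) ⟨
  toℚᵘ 1ℚ ℚᵘ.+ toℚᵘ (ℕtoℚ n)                   ≈⟨ ℚ.toℚᵘ-homo-+ 1ℚ (ℕtoℚ n) ⟨
  toℚᵘ (1ℚ +ℚ ℕtoℚ n)                          ∎)
  where
  open ℚᵘ.≃-Reasoning
  cross-multiplied : (ℤ.+ 1 ℤ.* ℤ.+ 1 ℤ.+ ℤ.+ n ℤ.* ℤ.+ 1) ℤ.* ℤ.+ 1 ≡ ℤ.+ suc n ℤ.* (ℤ.+ 1 ℤ.* ℤ.+ 1)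
  cross-multiplied =
    trans (ℤ.*-identityʳ _) (trans (cong (λ z → ℤ.+ 1 ℤ.+ z) (ℤ.*-identityʳ (ℤ.+ n))) (sym (ℤ.*-identityʳ _)))

ℕtoℚ≡·1 : ∀ n → ℕtoℚ n ≡ n · 1ℚ
ℕtoℚ≡·1 zero    = refl
ℕtoℚ≡·1 (suc n) = trans (ℕtoℚ-suc n) (cong (1ℚ +ℚ_) (ℕtoℚ≡·1 n))

ℕtoℚ-+ : ∀ m n → ℕtoℚ (m + n) ≡ ℕtoℚ m +ℚ ℕtoℚ n
ℕtoℚ-+ m n = trans (ℕtoℚ≡·1 (m + n)) (trans (×-homo-+ 1ℚ m n) (sym (cong₂ _+ℚ_ (ℕtoℚ≡·1 m) (ℕtoℚ≡·1 n))))

ℕtoℚ-* : ∀ m n → ℕtoℚ (m * n) ≡ ℕtoℚ m *ℚ ℕtoℚ n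
ℕtoℚ-* m n = trans (ℕtoℚ≡·1 (m * n)) (trans (×1-homo-* m n) (sym (cong₂ _*ℚ_ (ℕtoℚ≡·1 m) (ℕtoℚ≡·1 n))))

ℕtoℚ-sum : ∀ {n} (f : Fin n → ℕ) → ℕtoℚ (sumℕ f) ≡ sumℚ (ℕtoℚ ∘ f)
ℕtoℚ-sum {zero}  f = refl
ℕtoℚ-sum {suc n} f = trans (ℕtoℚ-+ (f zero) (sumℕ (f ∘ suc))) (cong (ℕtoℚ (f zero) +ℚ_) (ℕtoℚ-sum (f ∘ suc)))

ℕtoℚ-injective : ∀ {m n} → ℕtoℚ m ≡ ℕtoℚ n → m ≡ n
ℕtoℚ-injective {m} {n} eq with ℚᵘ.≃-trans (ℚᵘ.≃-sym (toℚᵘ-ℕtoℚ m)) (ℚᵘ.≃-trans (ℚ.toℚᵘ-cong eq) (toℚᵘ-ℕtoℚ n))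
... | ℚᵘ.*≡* cross = ℤ.+-injective (trans (sym (ℤ.*-identityʳ (ℤ.+ m))) (trans cross (ℤ.*-identityʳ (ℤ.+ n))))

sumℚ-const : ∀ n x → sumℚ {n} (λ _ → x) ≡ ℕtoℚ n *ℚ x
sumℚ-const zero    x = sym (ℚ.*-zeroˡ x)
sumℚ-const (suc n) x = begin
  x +ℚ sumℚ {n} (λ _ → x)      ≡⟨ cong (x +ℚ_) (sumℚ-const n x) ⟩
  x +ℚ ℕtoℚ n *ℚ x             ≡⟨ solve 2 (λ x m → x :+ m :* x := (con 1ℚ :+ m) :* x) refl x (ℕtoℚ n) ⟩
  (1ℚ +ℚ ℕtoℚ n) *ℚ x          ≡⟨ cong (_*ℚ x) (ℕtoℚ-suc n) ⟨
  ℕtoℚ (suc n) *ℚ x            ∎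
  where
  open ≡-Reasoning
  open +-*-Solver

rearrange : ∀ c x d y → c *ℚ x *ℚ (d *ℚ y) ≡ c *ℚ d *ℚ (x *ℚ y)
rearrange = solve 4 (λ c x d y → c :* x :* (d :* y) := c :* d :* (x :* y)) refl
  where open +-*-Solver

-- Linear combinations

module _ {k : ℕ} where

  homᵗ : ℚ × LGraph k → LGraph k → ℚ
  homᵗ (c , X) G = c *ℚ ℕtoℚ (hom X G)

  homL-++ : ∀ (𝐅 𝐇 : LinComb k) G → homL (𝐅 ++ 𝐇) G ≡ homL 𝐅 G +ℚ homL 𝐇 G
  homL-++ []      𝐇 G = sym (ℚ.+-identityˡ _)
  homL-++ (t ∷ 𝐅) 𝐇 G = trans (cong (homᵗ t G +ℚ_) (homL-++ 𝐅 𝐇 G)) (sym (ℚ.+-assoc (homᵗ t G) _ _))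

  scale : ℚ → LinComb k → LinComb k
  scale a = map (map₁ (a *ℚ_))

  homL-scale : ∀ a 𝐅 G → homL (scale a 𝐅) G ≡ a *ℚ homL 𝐅 G
  homL-scale a []            G = sym (ℚ.*-zeroʳ a)
  homL-scale a ((c , X) ∷ 𝐅) G =
    trans (cong₂ _+ℚ_ (ℚ.*-assoc a c _) (homL-scale a 𝐅 G)) (sym (ℚ.*-distribˡ-+ a _ _))

  InRL-scale : ∀ {q} a {𝐅} → InRL k q 𝐅 → InRL k q (scale a 𝐅)
  InRL-scale a = map⁺

  empty : LGraph k
  empty = record { size = 0 ; adj = λ () ; adj-sym = λ () ; adj-irr = λ () ; lab = λ _ → nothing }

  hom-empty : ∀ G → hom empty G ≡ 1
  hom-empty G = trans (hom-determined empty G (λ ()) (λ _ _ ()))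
                      (cong (λ b → if b then 1 else 0) (isHom-complete empty G (λ ()) ((λ ()) , λ _ _ ())))

  unit : LinComb k
  unit = (1ℚ , empty) ∷ []

  homL-unit : ∀ G → homL unit G ≡ 1ℚ
  homL-unit G = cong (λ m → 1ℚ *ℚ ℕtoℚ m +ℚ 0ℚ) (hom-empty G)

  InRL-unit : ∀ {q} → InRL k q unit
  InRL-unit = leaf (λ ()) ∷ []

  constant : ℚ → LinComb k
  constant a = scale a unit

  homL-constant : ∀ a G → homL (constant a) G ≡ a
  homL-constant a G = trans (homL-scale a unit G) (trans (cong (a *ℚ_) (homL-unit G)) (ℚ.*-identityʳ a))

  InRL-constant : ∀ {q} a → InRL k q (constant a)
  InRL-constant a = InRL-scale a InRL-unit

  -- A product term is dropped when gluing collapses an edge into a loop: it then has no homomorphisms at all.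
  productTerm : ∀ c d X Y → Dec (Collapses (product-isProduct X Y)) → LinComb k
  productTerm c d X Y (yes _) = []
  productTerm c d X Y (no _)  = (c *ℚ d , product X Y) ∷ []

  _⊗ᵗ_ : ℚ × LGraph k → ℚ × LGraph k → LinComb k
  (c , X) ⊗ᵗ (d , Y) = productTerm c d X Y (collapses? (product-isProduct X Y))

  homL-productTerm : ∀ c d X Y dec G → homL (productTerm c d X Y dec) G ≡ homᵗ (c , X) G *ℚ homᵗ (d , Y) G
  homL-productTerm c d X Y (yes collapse) G = sym (begin
    c *ℚ x *ℚ (d *ℚ y)      ≡⟨ rearrange c x d y ⟩
    c *ℚ d *ℚ (x *ℚ y)      ≡⟨ cong (c *ℚ d *ℚ_) (trans (sym (ℕtoℚ-* (hom X G) (hom Y G)))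
                                                    (cong ℕtoℚ (hom-collapse (product-isProduct X Y) G collapse))) ⟩
    c *ℚ d *ℚ 0ℚ            ≡⟨ ℚ.*-zeroʳ (c *ℚ d) ⟩
    0ℚ                      ∎)
    where
    open ≡-Reasoning
    x y : ℚ
    x = ℕtoℚ (hom X G)
    y = ℕtoℚ (hom Y G)
  homL-productTerm c d X Y (no no-collapse) G = begin
    c *ℚ d *ℚ ℕtoℚ (hom (product X Y) G) +ℚ 0ℚ
      ≡⟨ ℚ.+-identityʳ _ ⟩
    c *ℚ d *ℚ ℕtoℚ (hom (product X Y) G)
      ≡⟨ cong (λ z → c *ℚ d *ℚ ℕtoℚ z) (hom-product (product-isProduct X Y) G no-collapse) ⟩
    c *ℚ d *ℚ ℕtoℚ (hom X G * hom Y G)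
      ≡⟨ cong (c *ℚ d *ℚ_) (ℕtoℚ-* (hom X G) (hom Y G)) ⟩
    c *ℚ d *ℚ (ℕtoℚ (hom X G) *ℚ ℕtoℚ (hom Y G))
      ≡⟨ rearrange c (ℕtoℚ (hom X G)) d (ℕtoℚ (hom Y G)) ⟨
    c *ℚ ℕtoℚ (hom X G) *ℚ (d *ℚ ℕtoℚ (hom Y G)) ∎
    where open ≡-Reasoning

  homL-⊗ᵗ : ∀ s t G → homL (s ⊗ᵗ t) G ≡ homᵗ s G *ℚ homᵗ t G
  homL-⊗ᵗ (c , X) (d , Y) = homL-productTerm c d X Y (collapses? (product-isProduct X Y))

  InRL-productTerm : ∀ {q} c d {X Y} dec → InL k q X → InL k q Y → InRL k q (productTerm c d X Y dec)
  InRL-productTerm c d (yes _) x y = []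
  InRL-productTerm c d (no _)  x y = prod x y (product-isProduct _ _) ∷ []

  InRL-⊗ᵗ : ∀ {q} s t → InL k q (proj₂ s) → InL k q (proj₂ t) → InRL k q (s ⊗ᵗ t)
  InRL-⊗ᵗ (c , X) (d , Y) = InRL-productTerm c d (collapses? (product-isProduct X Y))

  _⊛_ : LinComb k → LinComb k → LinComb k
  𝐅 ⊛ 𝐇 = concatMap (λ s → concatMap (s ⊗ᵗ_) 𝐇) 𝐅

  homL-⊛ : ∀ 𝐅 𝐇 G → homL (𝐅 ⊛ 𝐇) G ≡ homL 𝐅 G *ℚ homL 𝐇 G
  homL-⊛ []      𝐇 G = sym (ℚ.*-zeroˡ (homL 𝐇 G))
  homL-⊛ (s ∷ 𝐅) 𝐇 G = begin
    homL (concatMap (s ⊗ᵗ_) 𝐇 ++ 𝐅 ⊛ 𝐇) G         ≡⟨ homL-++ (concatMap (s ⊗ᵗ_) 𝐇) (𝐅 ⊛ 𝐇) G ⟩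
    homL (concatMap (s ⊗ᵗ_) 𝐇) G +ℚ homL (𝐅 ⊛ 𝐇) G ≡⟨ cong₂ _+ℚ_ (row 𝐇) (homL-⊛ 𝐅 𝐇 G) ⟩
    homᵗ s G *ℚ homL 𝐇 G +ℚ homL 𝐅 G *ℚ homL 𝐇 G    ≡⟨ ℚ.*-distribʳ-+ (homL 𝐇 G) (homᵗ s G) (homL 𝐅 G) ⟨
    (homᵗ s G +ℚ homL 𝐅 G) *ℚ homL 𝐇 G               ∎
    where
    open ≡-Reasoning
    row : ∀ 𝐇 → homL (concatMap (s ⊗ᵗ_) 𝐇) G ≡ homᵗ s G *ℚ homL 𝐇 G
    row []      = sym (ℚ.*-zeroʳ (homᵗ s G))
    row (t ∷ 𝐇) = trans (homL-++ (s ⊗ᵗ t) (concatMap (s ⊗ᵗ_) 𝐇) G)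
      (trans (cong₂ _+ℚ_ (homL-⊗ᵗ s t G) (row 𝐇)) (sym (ℚ.*-distribˡ-+ (homᵗ s G) (homᵗ t G) (homL 𝐇 G))))

  InRL-⊛ : ∀ {q} {𝐅 𝐇} → InRL k q 𝐅 → InRL k q 𝐇 → InRL k q (𝐅 ⊛ 𝐇)
  InRL-⊛ []                  _  = []
  InRL-⊛ {𝐇 = 𝐇} (x ∷ 𝐅-ok) 𝐇-ok = ++⁺ (row 𝐇-ok) (InRL-⊛ 𝐅-ok 𝐇-ok)
    where
    row : ∀ {𝐇} → InRL k _ 𝐇 → InRL k _ (concatMap (_ ⊗ᵗ_) 𝐇)
    row []           = []
    row (y ∷ 𝐇-ok) = ++⁺ (InRL-⊗ᵗ _ _ x y) (row 𝐇-ok)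


  ∑ᴸ : ∀ {m} → (Fin m → LinComb k) → LinComb k
  ∑ᴸ {zero}  _  = []
  ∑ᴸ {suc m} 𝐅s = 𝐅s zero ++ ∑ᴸ (𝐅s ∘ suc)

  homL-∑ᴸ : ∀ {m} (𝐅s : Fin m → LinComb k) G → homL (∑ᴸ 𝐅s) G ≡ sumℚ (λ j → homL (𝐅s j) G)
  homL-∑ᴸ {zero}  𝐅s G = refl
  homL-∑ᴸ {suc m} 𝐅s G =
    trans (homL-++ (𝐅s zero) (∑ᴸ (𝐅s ∘ suc)) G) (cong (homL (𝐅s zero) G +ℚ_) (homL-∑ᴸ (𝐅s ∘ suc) G))

  InRL-∑ᴸ : ∀ {q m} {𝐅s : Fin m → LinComb k} → (∀ j → InRL k q (𝐅s j)) → InRL k q (∑ᴸ 𝐅s)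
  InRL-∑ᴸ {m = zero}  _  = []
  InRL-∑ᴸ {m = suc m} ok = ++⁺ (ok zero) (InRL-∑ᴸ (ok ∘ suc))

  ∏ᴸ : ∀ {m} → (Fin m → LinComb k) → LinComb k
  ∏ᴸ {zero}  _  = unit
  ∏ᴸ {suc m} 𝐅s = 𝐅s zero ⊛ ∏ᴸ (𝐅s ∘ suc)

  homL-∏ᴸ : ∀ {m} (𝐅s : Fin m → LinComb k) G → homL (∏ᴸ 𝐅s) G ≡ prodℚ (λ j → homL (𝐅s j) G)
  homL-∏ᴸ {zero}  𝐅s G = homL-unit G
  homL-∏ᴸ {suc m} 𝐅s G =
    trans (homL-⊛ (𝐅s zero) (∏ᴸ (𝐅s ∘ suc)) G) (cong (homL (𝐅s zero) G *ℚ_) (homL-∏ᴸ (𝐅s ∘ suc) G))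

  InRL-∏ᴸ : ∀ {q m} {𝐅s : Fin m → LinComb k} → (∀ j → InRL k q (𝐅s j)) → InRL k q (∏ᴸ 𝐅s)
  InRL-∏ᴸ {m = zero}  _  = InRL-unit
  InRL-∏ᴸ {m = suc m} ok = InRL-⊛ (ok zero) (InRL-∏ᴸ (ok ∘ suc))

InL-suc : ∀ {k q F} → InL k q F → InL k (suc q) F
InL-suc (leaf full)          = leaf full
InL-suc (elim i x removed)   = elim i (InL-suc x) removed
InL-suc (prod x y isProduct) = prod (InL-suc x) (InL-suc y) isProduct

InL-mono : ∀ {k q q′ F} → q ≤ q′ → InL k q F → InL k q′ F
InL-mono {q′ = zero}   z≤n x = x
InL-mono {q′ = suc q′} q≤ x with ℕ.m≤n⇒m<n∨m≡n q≤
... | inj₁ (s≤s q≤q′) = InL-suc (InL-mono q≤q′ x)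
... | inj₂ refl       = x

InRL-mono : ∀ {k q q′ 𝐅} → q ≤ q′ → InRL k q 𝐅 → InRL k q′ 𝐅
InRL-mono q≤q′ = All.map (InL-mono q≤q′)

module _ {k : ℕ} (n : ℕ) (i : Fin k) where

  -- If label i is absent, summing over its placements just multiplies by the number n of vertices.
  eliminateTerm : ℚ → (X : LGraph k) → Maybe (Fin (size X)) → ℚ × LGraph k
  eliminateTerm c X (just _) = c , removeLabel i X
  eliminateTerm c X nothing  = c *ℚ ℕtoℚ n , X

  eliminateᵗ : ℚ × LGraph k → ℚ × LGraph k
  eliminateᵗ (c , X) = eliminateTerm c X (lab X i)

  eliminate : LinComb k → LinComb k
  eliminate = map eliminateᵗ

  homᵗ-eliminateTerm : ∀ c X {l} → lab X i ≡ l → ∀ G → size G ≡ n →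
    homᵗ (eliminateTerm c X l) G ≡ sumℚ (λ v → homᵗ (c , X) (setLabel G i v))
  homᵗ-eliminateTerm c X {just u} Xi G refl = begin
    c *ℚ ℕtoℚ (hom (removeLabel i X) G)
      ≡⟨ cong (λ z → c *ℚ ℕtoℚ z) (hom-removeLabel {G = G} Xi) ⟩
    c *ℚ ℕtoℚ (sumℕ (λ v → hom X (setLabel G i v)))
      ≡⟨ cong (c *ℚ_) (ℕtoℚ-sum (λ v → hom X (setLabel G i v))) ⟩
    c *ℚ sumℚ (λ v → ℕtoℚ (hom X (setLabel G i v)))
      ≡⟨ *-distribˡ-sumℚ c (λ v → ℕtoℚ (hom X (setLabel G i v))) ⟩
    sumℚ (λ v → c *ℚ ℕtoℚ (hom X (setLabel G i v))) ∎
    where open ≡-Reasoning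
  homᵗ-eliminateTerm c X {nothing} Xi G refl = begin
    c *ℚ ℕtoℚ n *ℚ ℕtoℚ (hom X G)
      ≡⟨ solve 3 (λ c m h → c :* m :* h := m :* (c :* h)) refl c (ℕtoℚ n) (ℕtoℚ (hom X G)) ⟩
    ℕtoℚ n *ℚ (c *ℚ ℕtoℚ (hom X G))
      ≡⟨ sumℚ-const n (c *ℚ ℕtoℚ (hom X G)) ⟨
    sumℚ {n} (λ _ → c *ℚ ℕtoℚ (hom X G))
      ≡⟨ sumℚ-cong (λ v → cong (λ z → c *ℚ ℕtoℚ z) (hom-setLabel-unlabelled {F = X} {G = G} {i = i} Xi v)) ⟨
    sumℚ (λ v → c *ℚ ℕtoℚ (hom X (setLabel G i v))) ∎
    where
    open ≡-Reasoning
    open +-*-Solver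

  homᵗ-eliminateᵗ : ∀ t G → size G ≡ n → homᵗ (eliminateᵗ t) G ≡ sumℚ (λ v → homᵗ t (setLabel G i v))
  homᵗ-eliminateᵗ (c , X) = homᵗ-eliminateTerm c X refl

  homL-eliminate : ∀ 𝐅 G → size G ≡ n → homL (eliminate 𝐅) G ≡ sumℚ (λ v → homL 𝐅 (setLabel G i v))
  homL-eliminate []      G refl = sym (trans (sumℚ-const n 0ℚ) (ℚ.*-zeroʳ (ℕtoℚ n)))
  homL-eliminate (t ∷ 𝐅) G refl =
    trans (cong₂ _+ℚ_ (homᵗ-eliminateᵗ t G refl) (homL-eliminate 𝐅 G refl))
          (sym (∑-distrib-+ (λ v → homᵗ t (setLabel G i v)) (λ v → homL 𝐅 (setLabel G i v))))

  InRL-eliminate : ∀ {q 𝐅} → InRL k q 𝐅 → InRL k (suc q) (eliminate 𝐅)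
  InRL-eliminate = map⁺ ∘ All.map (λ {t} → InL-eliminateᵗ t)
    where
    InL-eliminateTerm : ∀ {q} c X l → InL k q X → InL k (suc q) (proj₂ (eliminateTerm c X l))
    InL-eliminateTerm c X (just _) x = elim i x (removeLabel-correct i X)
    InL-eliminateTerm c X nothing  x = InL-suc x
    InL-eliminateᵗ : ∀ {q} t → InL k q (proj₂ t) → InL k (suc q) (proj₂ (eliminateᵗ t))
    InL-eliminateᵗ (c , X) = InL-eliminateTerm c X (lab X i)

-- Lagrange interpolation

bool→ℚ : Bool → ℚ
bool→ℚ true  = 1ℚ
bool→ℚ false = 0ℚ

sumℚ-zero : ∀ {n} (f : Fin n → ℚ) → (∀ j → f j ≡ 0ℚ) → sumℚ f ≡ 0ℚ
sumℚ-zero {n} f all-zero = trans (sumℚ-cong all-zero) (trans (sumℚ-const n 0ℚ) (ℚ.*-zeroʳ (ℕtoℚ n)))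

prodℚ-zero : ∀ {m} (f : Fin m → ℚ) j → f j ≡ 0ℚ → prodℚ f ≡ 0ℚ
prodℚ-zero {suc m} f j fj≡0 = trans (prodℚ-remove {i = j} f)
  (trans (cong (_*ℚ prodℚ (removeAt f j)) fj≡0) (ℚ.*-zeroˡ (prodℚ (removeAt f j))))

module Interpolation {k : ℕ} (n : ℕ) where

  -- For j : Fin n, punchIn d j runs over the nodes 0 … n other than d.
  node : Fin (suc n) → Fin n → ℕ
  node d j = toℕ (punchIn d j)

  private
    distinct : ∀ d j → ℕtoℚ (toℕ d) ≢ ℕtoℚ (node d j)
    distinct d j = punchInᵢ≢i d j ∘ sym ∘ toℕ-injective ∘ ℕtoℚ-injective

  weight : Fin (suc n) → Fin n → ℚ
  weight d j = proj₁ (ℚ.#⇒invertible (distinct d j))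

  weight-inverse : ∀ d j → weight d j *ℚ (ℕtoℚ (toℕ d) - ℕtoℚ (node d j)) ≡ 1ℚ
  weight-inverse d j = proj₁ (proj₂ (ℚ.#⇒invertible (distinct d j)))

  lagrangeFactor : Fin (suc n) → LinComb k → Fin n → LinComb k
  lagrangeFactor d H j = scale (weight d j) (H ++ constant (- ℕtoℚ (node d j)))

  -- ∏_{e ≠ d} (H − e)/(d − e): the Lagrange basis polynomial of the node d, applied to H.
  lagrange : Fin (suc n) → LinComb k → LinComb k
  lagrange d H = ∏ᴸ (lagrangeFactor d H)

  thresholdTerm : ℕ → LinComb k → Fin (suc n) → LinComb k
  thresholdTerm t H d = if t ≤ᵇ toℕ d then lagrange d H else []

  -- On graphs where hom(H, G) is a node c, this evaluates to [t ≤ c]: only the basis polynomial of c survives.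
  threshold : ℕ → LinComb k → LinComb k
  threshold t H = ∑ᴸ (thresholdTerm t H)

  module _ {H : LinComb k} {G : LGraph k} {c : Fin (suc n)} (H≡c : homL H G ≡ ℕtoℚ (toℕ c)) where

    homL-lagrangeFactor : ∀ d j → homL (lagrangeFactor d H j) G ≡ weight d j *ℚ (ℕtoℚ (toℕ c) - ℕtoℚ (node d j))
    homL-lagrangeFactor d j = trans (homL-scale (weight d j) (H ++ constant e) G)
      (cong (weight d j *ℚ_) (trans (homL-++ H (constant e) G) (cong₂ _+ℚ_ H≡c (homL-constant e G))))
      where
      e : ℚ
      e = - ℕtoℚ (node d j)

    lagrange-at-node : homL (lagrange c H) G ≡ 1ℚ
    lagrange-at-node = trans (homL-∏ᴸ (lagrangeFactor c H) G)
      (trans (prodℚ-cong (λ j → trans (homL-lagrangeFactor c j) (weight-inverse c j))) (prodℚ-ones n))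

    lagrange-off-node : ∀ {d} → d ≢ c → homL (lagrange d H) G ≡ 0ℚ
    lagrange-off-node {d} d≢c = trans (homL-∏ᴸ (lagrangeFactor d H) G)
      (prodℚ-zero (λ j → homL (lagrangeFactor d H j) G) j₀ (trans (homL-lagrangeFactor d j₀) (begin
        weight d j₀ *ℚ (ℕtoℚ (toℕ c) - ℕtoℚ (node d j₀))
          ≡⟨ cong (λ z → weight d j₀ *ℚ (ℕtoℚ (toℕ c) - ℕtoℚ (toℕ z))) (punchIn-punchOut d≢c) ⟩
        weight d j₀ *ℚ (ℕtoℚ (toℕ c) - ℕtoℚ (toℕ c))
          ≡⟨ cong (weight d j₀ *ℚ_) (ℚ.+-inverseʳ (ℕtoℚ (toℕ c))) ⟩
        weight d j₀ *ℚ 0ℚ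
          ≡⟨ ℚ.*-zeroʳ (weight d j₀) ⟩
        0ℚ ∎)))
      where
      open ≡-Reasoning
      j₀ : Fin n
      j₀ = punchOut d≢c

    threshold-at-node : ∀ t → homL (threshold t H) G ≡ bool→ℚ (t ≤ᵇ toℕ c)
    threshold-at-node t = begin
      homL (threshold t H) G
        ≡⟨ homL-∑ᴸ (thresholdTerm t H) G ⟩
      sumℚ term
        ≡⟨ sumℚ-remove {i = c} term ⟩
      term c +ℚ sumℚ (removeAt term c)
        ≡⟨ cong₂ _+ℚ_ (at-node (t ≤ᵇ toℕ c))
                      (sumℚ-zero (removeAt term c) λ j → off-node (t ≤ᵇ toℕ (punchIn c j)) (punchInᵢ≢i c j)) ⟩
      bool→ℚ (t ≤ᵇ toℕ c) +ℚ 0ℚ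
        ≡⟨ ℚ.+-identityʳ (bool→ℚ (t ≤ᵇ toℕ c)) ⟩
      bool→ℚ (t ≤ᵇ toℕ c) ∎
      where
      open ≡-Reasoning
      term : Fin (suc n) → ℚ
      term d = homL (thresholdTerm t H d) G
      at-node : ∀ b → homL (if b then lagrange c H else []) G ≡ bool→ℚ b
      at-node true  = lagrange-at-node
      at-node false = refl
      off-node : ∀ b {d} → d ≢ c → homL (if b then lagrange d H else []) G ≡ 0ℚ
      off-node true  d≢c = lagrange-off-node d≢c
      off-node false _   = refl

  InRL-threshold : ∀ {q} t {H} → InRL k q H → InRL k q (threshold t H)
  InRL-threshold {q} t {H} H-ok = InRL-∑ᴸ λ d → selected (t ≤ᵇ toℕ d) d
    where
    selected : ∀ b d → InRL k q (if b then lagrange d H else [])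
    selected true  d = InRL-∏ᴸ λ j → InRL-scale (weight d j) (++⁺ H-ok (InRL-constant (- ℕtoℚ (node d j))))
    selected false d = []

-- Translating counting logic

sumℚ-bool→ℚ : ∀ {n} (p : Fin n → Bool) → sumℚ (bool→ℚ ∘ p) ≡ ℕtoℚ (count p (allFin n))
sumℚ-bool→ℚ p = sym (trans (cong ℕtoℚ (count-tabulate p (λ x → x)))
                     (trans (ℕtoℚ-sum (λ x → count p (x ∷ []))) (sumℚ-cong (λ x → single (p x) (count-∷ p x [])))))
  where
  single : ∀ b {m} → m ≡ (if b then 1 else 0) → ℕtoℚ m ≡ bool→ℚ b
  single true  refl = refl
  single false refl = refl

bool→ℚ-injective : ∀ {a b} → bool→ℚ a ≡ bool→ℚ b → a ≡ b
bool→ℚ-injective {true}  {true}  _ = refl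
bool→ℚ-injective {false} {false} _ = refl

homL-single : ∀ {k} {E G : LGraph k} {b} → hom E G ≡ (if b then 1 else 0) → homL ((1ℚ , E) ∷ []) G ≡ bool→ℚ b
homL-single {b = true}  hom≡ = cong (λ m → 1ℚ *ℚ ℕtoℚ m +ℚ 0ℚ) hom≡
homL-single {b = false} hom≡ = cong (λ m → 1ℚ *ℚ ℕtoℚ m +ℚ 0ℚ) hom≡

module _ {k} {G : LGraph k} {i : Fin k} {v : Fin (size G)} where

  sat-setLabel : ∀ φ α → sat (setLabel G i v) φ α ≡ sat G φ α
  sat-setLabel (eqA _ _)       α = refl
  sat-setLabel (edgeA _ _)     α = refl
  sat-setLabel (neg φ)         α = cong not (sat-setLabel φ α)
  sat-setLabel (conj φ ψ)      α = cong₂ _∧_ (sat-setLabel φ α) (sat-setLabel ψ α)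
  sat-setLabel (exists≥ t j φ) α = cong (t ≤ᵇ_) (count-cong (λ w → sat-setLabel φ (update α j w)) (allFin (size G)))

module CountingLogic (k n : ℕ) where

  Computes : Formula k → LinComb k → Set
  Computes φ 𝐅 = ∀ (G : LGraph k) (α : Fin k → Fin (size G)) → size G ≡ n →
    (∀ i → Free i φ → lab G i ≡ just (α i)) → homL 𝐅 G ≡ bool→ℚ (sat G φ α)

  Translation : Formula k → Set
  Translation φ = Σ (LinComb k) λ 𝐅 → InRL k (qr φ) 𝐅 × Computes φ 𝐅

  equality : ∀ i j → Translation (eqA i j)
  equality i j = (1ℚ , E) ∷ [] , leaf (λ { zero → i , labelled-i }) ∷ [] , computes
    where
    E : LGraph k
    E = record { size = 1 ; adj = λ _ _ → false ; adj-sym = λ _ _ → refl ; adj-irr = λ _ → refl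
               ; lab = λ l → if ⌊ l ≟ i ⌋ ∨ ⌊ l ≟ j ⌋ then just zero else nothing }
    labelled-i : lab E i ≡ just zero
    labelled-i with i ≟ i
    ... | yes _  = refl
    ... | no i≢i = ⊥-elim (i≢i refl)
    labelled-j : lab E j ≡ just zero
    labelled-j with j ≟ i | j ≟ j
    ... | yes _ | _      = refl
    ... | no _  | yes _  = refl
    ... | no _  | no j≢j = ⊥-elim (j≢j refl)
    labelled⁻ : ∀ l {u} → lab E l ≡ just u → l ≡ i ⊎ l ≡ j
    labelled⁻ l El with l ≟ i | l ≟ j
    ... | yes l≡i | _       = inj₁ l≡i
    ... | no _    | yes l≡j = inj₂ l≡j
    labelled⁻ l () | no _ | no _
    computes : Computes (eqA i j) ((1ℚ , E) ∷ [])
    computes G α _ agree =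
      homL-single {E = E} {G = G} (trans (hom-determined E G h₀ forced) (cong (λ b → if b then 1 else 0) isHom≡))
      where
      h₀ : Fin 1 → Fin (size G)
      h₀ _ = α i
      forced : ∀ h → IsHom E G h → h ≗ h₀
      forced h (_ , labels) zero = just-injective (trans (sym (labels i zero labelled-i)) (agree i (eqˡ j)))
      isHom≡ : isHom E G h₀ ≡ ⌊ α i ≟ α j ⌋
      isHom≡ = ⇔→≡ {z = true} (mk⇔
        (λ ok → Equivalence.from (isYes⇔ (α i ≟ α j))
           (just-injective (trans (sym (proj₂ (isHom-sound E G h₀ ok) j zero labelled-j)) (agree j (eqʳ i)))))
        (λ same → isHom-complete E G h₀ ((λ _ _ ()) , λ l u El → case labelled⁻ l El of λ where
           (inj₁ refl) → agree i (eqˡ j)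
           (inj₂ refl) → trans (agree j (eqʳ i)) (cong just (sym (Equivalence.to (isYes⇔ (α i ≟ α j)) same))))))

  edge : ∀ i j → Translation (edgeA i j)
  edge i j with i ≟ j
  ... | yes refl = [] , [] , λ G α _ _ → cong bool→ℚ (sym (adj-irr G (α i)))
  ... | no i≢j = (1ℚ , E) ∷ [] , leaf full ∷ [] , computes
    where
    E : LGraph k
    E = record { size = 2 ; adj = adjacent ; adj-sym = adjacent-sym ; adj-irr = adjacent-irr
               ; lab = λ l → if ⌊ l ≟ i ⌋ then just zero else if ⌊ l ≟ j ⌋ then just (suc zero) else nothing }
      where
      adjacent : Fin 2 → Fin 2 → Bool
      adjacent zero       (suc zero) = true
      adjacent (suc zero) zero       = true
      adjacent _          _          = false
      adjacent-sym : ∀ x y → adjacent x y ≡ adjacent y x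
      adjacent-sym zero       zero       = refl
      adjacent-sym zero       (suc zero) = refl
      adjacent-sym (suc zero) zero       = refl
      adjacent-sym (suc zero) (suc zero) = refl
      adjacent-irr : ∀ x → adjacent x x ≡ false
      adjacent-irr zero       = refl
      adjacent-irr (suc zero) = refl
    labelled-i : lab E i ≡ just zero
    labelled-i = if-≟-refl {i = i}
    labelled-j : lab E j ≡ just (suc zero)
    labelled-j = trans (if-≟-≢ (i≢j ∘ sym)) (if-≟-refl {i = j})
    labelled⁻ : ∀ l {u} → lab E l ≡ just u → (l ≡ i × u ≡ zero) ⊎ (l ≡ j × u ≡ suc zero)
    labelled⁻ l El with l ≟ i | l ≟ j
    labelled⁻ l refl | yes l≡i | _       = inj₁ (l≡i , refl)
    labelled⁻ l refl | no _    | yes l≡j = inj₂ (l≡j , refl)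
    labelled⁻ l ()   | no _    | no _
    full : FullyLabelled E
    full zero       = i , labelled-i
    full (suc zero) = j , labelled-j
    computes : Computes (edgeA i j) ((1ℚ , E) ∷ [])
    computes G α _ agree =
      homL-single {E = E} {G = G} (trans (hom-determined E G h₀ forced) (cong (λ b → if b then 1 else 0) isHom≡))
      where
      h₀ : Fin 2 → Fin (size G)
      h₀ zero    = α i
      h₀ (suc _) = α j
      forced : ∀ h → IsHom E G h → h ≗ h₀
      forced h (_ , labels) zero       = just-injective (trans (sym (labels i zero labelled-i)) (agree i (edgeˡ j)))
      forced h (_ , labels) (suc zero) = just-injective (trans (sym (labels j (suc zero) labelled-j)) (agree j (edgeʳ i)))
      isHom≡ : isHom E G h₀ ≡ adj G (α i) (α j)
      isHom≡ = ⇔→≡ {z = true} (mk⇔ (λ ok → proj₁ (isHom-sound E G h₀ ok) zero (suc zero) refl)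
        (λ a → isHom-complete E G h₀ (edges a , labels)))
        where
        edges : adj G (α i) (α j) ≡ true → ∀ x y → adj E x y ≡ true → adj G (h₀ x) (h₀ y) ≡ true
        edges a zero       (suc zero) _ = a
        edges a (suc zero) zero       _ = trans (adj-sym G (α j) (α i)) a
        labels : ∀ l u → lab E l ≡ just u → lab G l ≡ just (h₀ u)
        labels l u El with labelled⁻ l El
        ... | inj₁ (refl , refl) = agree i (edgeˡ j)
        ... | inj₂ (refl , refl) = agree j (edgeʳ i)

  negation : ∀ φ → Translation φ → Translation (neg φ)
  negation φ (𝐅 , ok , computes) = unit ++ scale (- 1ℚ) 𝐅 , ++⁺ InRL-unit (InRL-scale (- 1ℚ) ok) , computes′
    where
    complement : ∀ b → 1ℚ +ℚ - 1ℚ *ℚ bool→ℚ b ≡ bool→ℚ (not b)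
    complement true  = refl
    complement false = refl
    computes′ : Computes (neg φ) (unit ++ scale (- 1ℚ) 𝐅)
    computes′ G α size≡ agree = begin
      homL (unit ++ scale (- 1ℚ) 𝐅) G
        ≡⟨ homL-++ unit (scale (- 1ℚ) 𝐅) G ⟩
      homL unit G +ℚ homL (scale (- 1ℚ) 𝐅) G
        ≡⟨ cong₂ _+ℚ_ (homL-unit G) (homL-scale (- 1ℚ) 𝐅 G) ⟩
      1ℚ +ℚ - 1ℚ *ℚ homL 𝐅 G
        ≡⟨ cong (λ z → 1ℚ +ℚ - 1ℚ *ℚ z) (computes G α size≡ (λ i → agree i ∘ negF)) ⟩
      1ℚ +ℚ - 1ℚ *ℚ bool→ℚ (sat G φ α)
        ≡⟨ complement (sat G φ α) ⟩
      bool→ℚ (not (sat G φ α)) ∎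
      where open ≡-Reasoning

  conjunction : ∀ φ ψ → Translation φ → Translation ψ → Translation (conj φ ψ)
  conjunction φ ψ (𝐅 , ok , computes) (𝐇 , ok′ , computes′) =
    𝐅 ⊛ 𝐇 , InRL-⊛ (InRL-mono (m≤m⊔n (qr φ) (qr ψ)) ok) (InRL-mono (m≤n⊔m (qr φ) (qr ψ)) ok′) , computes″
    where
    both : ∀ a b → bool→ℚ a *ℚ bool→ℚ b ≡ bool→ℚ (a ∧ b)
    both true  true  = refl
    both true  false = refl
    both false true  = refl
    both false false = refl
    computes″ : Computes (conj φ ψ) (𝐅 ⊛ 𝐇)
    computes″ G α size≡ agree = trans (homL-⊛ 𝐅 𝐇 G)
      (trans (cong₂ _*ℚ_ (computes G α size≡ (λ i → agree i ∘ conjˡ)) (computes′ G α size≡ (λ i → agree i ∘ conjʳ)))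
             (both (sat G φ α) (sat G ψ α)))

  open Interpolation {k} n

  counting : ∀ t i φ → Translation φ → Translation (exists≥ t i φ)
  counting t i φ (𝐅 , ok , computes) =
    threshold t (eliminate n i 𝐅) , InRL-threshold t (InRL-eliminate n i ok) , computes′
    where
    computes′ : Computes (exists≥ t i φ) (threshold t (eliminate n i 𝐅))
    computes′ G α size≡ agree =
      trans (threshold-at-node eliminated t) (cong (λ c → bool→ℚ (t ≤ᵇ c)) (toℕ-fromℕ< witnesses<n))
      where
      witnesses : ℕ
      witnesses = count (λ v → sat G φ (update α i v)) (allFin (size G))
      witnesses<n : witnesses < suc n
      witnesses<n = s≤s (subst (witnesses ≤_) (trans (length-tabulate (λ x → x)) size≡) (count≤length _ (allFin (size G))))
      agree′ : ∀ v l → Free l φ → lab (setLabel G i v) l ≡ just (update α i v l)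
      agree′ v l free with l ≟ i
      ... | yes refl = refl
      ... | no l≢i   = agree l (existsF (l≢i ∘ sym) free)
      eliminated : homL (eliminate n i 𝐅) G ≡ ℕtoℚ (toℕ (fromℕ< witnesses<n))
      eliminated = begin
        homL (eliminate n i 𝐅) G
          ≡⟨ homL-eliminate n i 𝐅 G size≡ ⟩
        sumℚ (λ v → homL 𝐅 (setLabel G i v))
          ≡⟨ sumℚ-cong (λ v → computes (setLabel G i v) (update α i v) size≡ (agree′ v)) ⟩
        sumℚ (λ v → bool→ℚ (sat (setLabel G i v) φ (update α i v)))
          ≡⟨ sumℚ-cong (λ v → cong bool→ℚ (sat-setLabel φ (update α i v))) ⟩
        sumℚ (λ v → bool→ℚ (sat G φ (update α i v)))
          ≡⟨ sumℚ-bool→ℚ (λ v → sat G φ (update α i v)) ⟩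
        ℕtoℚ witnesses
          ≡⟨ cong ℕtoℚ (toℕ-fromℕ< witnesses<n) ⟨
        ℕtoℚ (toℕ (fromℕ< witnesses<n)) ∎
        where open ≡-Reasoning

  translate : ∀ φ → Translation φ
  translate (eqA i j)       = equality i j
  translate (edgeA i j)     = edge i j
  translate (neg φ)         = negation φ (translate φ)
  translate (conj φ ψ)      = conjunction φ ψ (translate φ) (translate ψ)
  translate (exists≥ t i φ) = counting t i φ (translate φ)

computes⇒models : ∀ {k m φ 𝐅} → CountingLogic.Computes k (suc m) φ 𝐅 → ModelsFor 𝐅 φ (suc m)
computes⇒models {k} {m} {φ} {𝐅} computes G size≡ labelled = models , ¬models
  where
  α : Fin k → Fin (size G)
  α l = fromMaybe (subst Fin (sym size≡) zero) (lab G l)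
  agree : ∀ l → Free l φ → lab G l ≡ just (α l)
  agree l free with lab G l | labelled l free
  ... | just _ | is-just _ = refl
  value : homL 𝐅 G ≡ bool→ℚ (sat G φ α)
  value = computes G α size≡ agree
  models : G ⊨ φ → homL 𝐅 G ≡ 1ℚ
  models G⊨φ = trans value (cong bool→ℚ (G⊨φ α agree))
  ¬models : ¬ (G ⊨ φ) → homL 𝐅 G ≡ 0ℚ
  ¬models G⊭φ with sat G φ α in sat≡
  ... | false = trans value (cong bool→ℚ sat≡)
  -- Every assignment agreeing with the labels of G has truth value read off from homL 𝐅 G.
  ... | true  = ⊥-elim (G⊭φ λ β agreeβ →
    bool→ℚ-injective (trans (sym (computes G β size≡ agreeβ)) (trans value (cong bool→ℚ sat≡))))

lemma25 : (k q : ℕ) → 1 ≤ k → 1 ≤ q → (φ : Formula k) → qr φ ≤ q →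
    (n : ℕ) → 1 ≤ n → ∃[ 𝐅 ] (InRL k q 𝐅 × ModelsFor 𝐅 φ n)
lemma25 k q _ _ φ qr≤q (suc m) _ =
  let 𝐅 , ok , computes = CountingLogic.translate k (suc m) φ
  in  𝐅 , InRL-mono qr≤q ok , computes⇒models {𝐅 = 𝐅} computes
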